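{- Let $d\ge 1$, $\pi\in NC(d)$, and let $\mathcal S$ be a family of pairwise disjoint intervals of $[1,d]$ as in the context, with associated family $\mathcal S'$. Then $wt_{\mathcal S}(\pi)\cdot wt_{\mathcal S'}(\alpha(\pi))=x^{d+1}$.
   Context: $NC(d)$ is the set of noncrossing partitions of $[1,d]$. For $\pi\in NC(d)$: a singleton is an element forming a block by itself; $\mathrm{block}(\pi)$ is the number of blocks of size at least $2$; $k\in[1,d]$ is an antisingleton if $k$ and $k+1$ lie in the same block, with $d+1$ read as $1$. Intervals: for $1\le k,l\le d$, $[k,l]=\{k,\dots,l\}$ if $k\le l$, and $[k,l]=\{k,\dots,d,1,\dots,l\}$ (wrapped) if $k>l$. A family $\mathcal S=\{[k_1,l_1],\dots,[k_i,l_i]\}$, $i\ge1$, of pairwise disjoint intervals is listed so that $1\le k_1\le l_1<k_2\le\dots<k_i\le d$ and either $k_i\le l_i\le d$ or $1\le l_i<k_1$. Its associated family is $\mathcal S'=\{[d-k_i+1,d-l_{i-1}],\dots,[d-k_2+1,d-l_1],[d-k_1+1,d-l_i]\}$, where an endpoint $0$ is read as $d$ and $[a,b]$ with $a>b$ is wrapped. Weight: given $\pi$ and a family $\mathcal T$ of intervals, a singleton is in $\mathcal T$ if it lies in an interval of $\mathcal T$; an antisingleton $k\le d-1$ is in $\mathcal T$ if $\{k,k+1\}$ lies in a single interval of $\mathcal T$; the antisingleton $d$ is in $\mathcal T$ iff $\mathcal T$ contains a wrapped interval. $wt_{\mathcal T}(\pi)=x^{\mathrm{block}(\pi)+s+a}$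 where $s$ (resp. $a$) counts singletons (resp. antisingletons) of $\pi$ in $\mathcal T$. The Simion–Ullman involution $\alpha$: place $1,\dots,d$ clockwise on a circle, put $(d-i)'$ on the arc between $i$ and $i+1$ ($1\le i\le d-1$) and $d'$ between $d$ and $1$; $\alpha(\pi)$ is the coarsest noncrossing partition of $\{1',\dots,d'\}$ whose block convex hulls do not intersect those of the blocks of $\pi$, with $i'$ identified with $i$. -}

module Defs where

open import Data.Nat using (ℕ; zero; suc; _+_; _*_; _∸_; _≤_; _<_; _≤ᵇ_; _≡ᵇ_; _<ᵇ_)
open import Data.Bool using (Bool; true; false; _∧_; _∨_; not; if_then_else_)
open import Data.List using (List; []; _∷_)
open import Data.Bool.ListAction using (any)
open import Data.Product using (_×_; _,_; proj₂)
open import Data.Sum using (_⊎_)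
open import Data.Empty using (⊥)
open import Relation.Binary.PropositionalEquality using (_≡_)

-- A set partition of [1,d] is given by a block-labelling π : ℕ → ℕ;
-- i, j ∈ [1,d] lie in the same block iff π i ≡ π j.  Values outside [1,d]
-- are irrelevant.

IsNC : ℕ → (ℕ → ℕ) → Set
IsNC d π = ∀ a b c e → 1 ≤ a → a < b → b < c → c < e → e ≤ d →
           π a ≡ π c → π b ≡ π e → π a ≡ π b

anyUpTo : ℕ → (ℕ → Bool) → Bool
anyUpTo zero    p = false
anyUpTo (suc n) p = p (suc n) ∨ anyUpTo n p

countUpTo : ℕ → (ℕ → Bool) → ℕ
countUpTo zero    p = 0
countUpTo (suc n) p = (if p (suc n) then 1 else 0) + countUpTo n p

sameB : (ℕ → ℕ) → ℕ → ℕ → Bool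
sameB π i j = π i ≡ᵇ π j

isSingleton : ℕ → (ℕ → ℕ) → ℕ → Bool
isSingleton d π k = not (anyUpTo d (λ j → not (j ≡ᵇ k) ∧ sameB π j k))

next : ℕ → ℕ → ℕ
next d k = if k ≡ᵇ d then 1 else suc k

isAnti : ℕ → (ℕ → ℕ) → ℕ → Bool
isAnti d π k = sameB π k (next d k)

isMinOfBigBlock : ℕ → (ℕ → ℕ) → ℕ → Bool
isMinOfBigBlock d π k =
  not (anyUpTo (k ∸ 1) (λ j → sameB π j k)) ∧
  anyUpTo d (λ j → not (j ≡ᵇ k) ∧ sameB π j k)

block : ℕ → (ℕ → ℕ) → ℕ
block d π = countUpTo d (isMinOfBigBlock d π)

-- Intervals [k,l] of [1,d] as pairs (k , l); wrapped when k > l.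
Interval : Set
Interval = ℕ × ℕ

inIv : ℕ → Interval → ℕ → Bool
inIv d (k , l) j =
  if k ≤ᵇ l then ((k ≤ᵇ j) ∧ (j ≤ᵇ l))
  else (((k ≤ᵇ j) ∧ (j ≤ᵇ d)) ∨ ((1 ≤ᵇ j) ∧ (j ≤ᵇ l)))

isWrapped : Interval → Bool
isWrapped (k , l) = l <ᵇ k

inFam : ℕ → List Interval → ℕ → Bool
inFam d T j = any (λ I → inIv d I j) T

-- For k ≤ d-1 we require k, k+1 in a single
-- interval I with k not the right endpoint of I (i.e. k → k+1 is a step
-- inside I).  This agrees with plain containment of {k,k+1} except for a
-- wrapped interval [l+1,l] covering the whole circle.
antiIn : ℕ → List Interval → ℕ → Bool
antiIn d T k =
  if k ≡ᵇ d then any isWrapped T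
  else any (λ I → inIv d I k ∧ inIv d I (suc k) ∧ not (k ≡ᵇ proj₂ I)) T

-- exponent of wt_T(π) = x^(block(π) + s + a)
wtExp : ℕ → List Interval → (ℕ → ℕ) → ℕ
wtExp d T π =
  block d π
  + countUpTo d (λ k → isSingleton d π k ∧ inFam d T k)
  + countUpTo d (λ k → isAnti d π k ∧ antiIn d T k)

-- Admissible families S = [ (k₁,l₁) , … , (kᵢ,lᵢ) ], i ≥ 1, with
-- 1 ≤ k₁ ≤ l₁ < k₂ ≤ … < kᵢ ≤ d and (kᵢ ≤ lᵢ ≤ d or 1 ≤ lᵢ < k₁).
-- Chain d k₁ lo S : the remaining intervals, each left end ≥ lo.
Chain : ℕ → ℕ → ℕ → List Interval → Set
Chain d k₁ lo [] = ⊥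
Chain d k₁ lo ((k , l) ∷ []) =
  lo ≤ k × k ≤ d × ((k ≤ l × l ≤ d) ⊎ (1 ≤ l × l < k₁))
Chain d k₁ lo ((k , l) ∷ (p ∷ ps)) =
  lo ≤ k × k ≤ l × Chain d k₁ (suc l) (p ∷ ps)

Family : ℕ → List Interval → Set
Family d [] = ⊥
Family d ((k , l) ∷ ps) = Chain d k 1 ((k , l) ∷ ps)

conv : ℕ → ℕ → ℕ
conv d a = if a ≡ᵇ 0 then d else a

-- associated family S' (as a list; order is irrelevant for the weight):
-- [d-k_j+1, d-l_{j-1}] for j = 2..i, and [d-k₁+1, d-l_i].
assoc : ℕ → List Interval → List Interval
assoc d [] = []
assoc d ((k₁ , l₁) ∷ ps) = go l₁ ps
  where
  go : ℕ → List Interval → List Interval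
  go lprev [] = (suc (d ∸ k₁) , conv d (d ∸ lprev)) ∷ []
  go lprev ((k , l) ∷ qs) = (suc (d ∸ k) , conv d (d ∸ lprev)) ∷ go l qs

-- Positions on the circle (0 .. 2d-1, clockwise): i ∈ [1,d] sits at 2(i-1);
-- j' sits between d-j and d-j+1, i.e. at 2(d-j)-1 for j < d, and d' at 2d-1.
posU : ℕ → ℕ
posU i = 2 * i ∸ 2

posP : ℕ → ℕ → ℕ
posP d j = if j ≡ᵇ d then 2 * d ∸ 1 else 2 * (d ∸ j) ∸ 1

-- Convex hulls of blocks of π (unprimed) and of σ (primed points) are
-- disjoint iff no block of π interleaves with a block of σ on the circle.
Compatible : ℕ → (ℕ → ℕ) → (ℕ → ℕ) → Set
Compatible d π σ =
  ∀ a c b e → 1 ≤ a → a ≤ d → 1 ≤ c → c ≤ d → 1 ≤ b → b ≤ d → 1 ≤ e → e ≤ d →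
  π a ≡ π c → σ b ≡ σ e →
  (posU a < posP d b → posP d b < posU c → posU c < posP d e → ⊥) ×
  (posP d b < posU a → posU a < posP d e → posP d e < posU c → ⊥)

-- σ (a partition of {1',…,d'} with i' identified with i) is α(π):
-- the coarsest noncrossing partition compatible with π.
IsAlpha : ℕ → (ℕ → ℕ) → (ℕ → ℕ) → Set
IsAlpha d π σ =
  IsNC d σ × Compatible d π σ ×
  (∀ τ → IsNC d τ → Compatible d π τ →
     ∀ i j → 1 ≤ i → i ≤ d → 1 ≤ j → j ≤ d → τ i ≡ τ j → σ i ≡ σ j)

-- Write gapAfter d g for the primed point between g and g + 1. Two such gaps g < h lie in one
-- block of σ = α(π) iff the arc [g + 1, h] is a union of blocks of π: σ is compatible with π, and
-- when the arc is closed, merging the two gaps is still compatible, so maximality of σ applies.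
-- Hence gapAfter d g is a singleton of σ iff g is an antisingleton of π, gapAfter d k is an
-- antisingleton of σ iff k is a singleton of π, and counting least elements of blocks shows that
-- π and σ have d + 1 blocks together. Going around the circle, the intervals of S alternate with
-- the gaps between them, and gapAfter turns those gaps into the intervals of S′; so x lies in S iff
-- the antisingleton gapAfter d x is not in S′, and the antisingleton g is in S iff gapAfter d g is
-- not in S′. The exponents of the two weights therefore add up to
-- block π + #singletons π + block σ + #singletons σ = #blocks π + #blocks σ = d + 1.

module Submission where

open import Defs
open import Data.Nat
  using (ℕ; zero; suc; _+_; _*_; _∸_; _≤_; _<_; _≤ᵇ_; _<ᵇ_; _≡ᵇ_; z≤n; s≤s; _≟_; _≤?_; _<?_)
open import Data.Nat.Properties
open import Data.Nat.Tactic.RingSolver using (solve-∀)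
open import Data.Bool using (Bool; true; false; _∧_; _∨_; not; if_then_else_; T)
open import Data.Bool.Properties using (∧-zeroʳ; ∧-identityʳ; ∨-zeroʳ; ∨-identityʳ)
open import Data.Bool.ListAction using (any)
open import Data.List using (List; []; _∷_)
open import Data.Product using (∃; _×_; _,_; proj₁; proj₂)
open import Data.Sum using (_⊎_; inj₁; inj₂)
open import Data.Unit using (tt)
open import Data.Empty using (⊥; ⊥-elim)
open import Relation.Nullary using (yes; no)
open import Relation.Nullary.Decidable using (dec-true; dec-false)
open import Relation.Binary.PropositionalEquality
open import Relation.Binary.Definitions using (tri<; tri≈; tri>)

ind : Bool → ℕ
ind b = if b then 1 else 0

ind-not : ∀ b → ind b + ind (not b) ≡ 1
ind-not true  = refl
ind-not false = refl

≡not-of-ind : ∀ {a b} → ind a + ind b ≡ 1 → b ≡ not a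
≡not-of-ind {true}  {false} _ = refl
≡not-of-ind {false} {true}  _ = refl

true≢false : true ≢ false
true≢false ()

≤ᵇ-true : ∀ {m n} → m ≤ n → (m ≤ᵇ n) ≡ true
≤ᵇ-true {m} {n} = dec-true (m ≤? n)

≤ᵇ-false : ∀ {m n} → n < m → (m ≤ᵇ n) ≡ false
≤ᵇ-false {m} {n} n<m = dec-false (m ≤? n) (<⇒≱ n<m)

<ᵇ-true : ∀ {m n} → m < n → (m <ᵇ n) ≡ true
<ᵇ-true {m} {n} = dec-true (m <? n)

<ᵇ-false : ∀ {m n} → n ≤ m → (m <ᵇ n) ≡ false
<ᵇ-false {m} {n} n≤m = dec-false (m <? n) (≤⇒≯ n≤m)

≡ᵇ-true : ∀ {m n} → m ≡ n → (m ≡ᵇ n) ≡ true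
≡ᵇ-true {m} {n} = dec-true (m ≟ n)

≡ᵇ-false : ∀ {m n} → m ≢ n → (m ≡ᵇ n) ≡ false
≡ᵇ-false {m} {n} = dec-false (m ≟ n)

≡ᵇ-refl : ∀ n → (n ≡ᵇ n) ≡ true
≡ᵇ-refl n = ≡ᵇ-true {n} refl

≡ᵇ-true⁻ : ∀ {m n} → (m ≡ᵇ n) ≡ true → m ≡ n
≡ᵇ-true⁻ {m} {n} e = ≡ᵇ⇒≡ m n (subst T (sym e) tt)

≡ᵇ-false⁻ : ∀ {m n} → (m ≡ᵇ n) ≡ false → m ≢ n
≡ᵇ-false⁻ e m≡n = true≢false (trans (sym (≡ᵇ-true m≡n)) e)

≡ᵇ-≡ : ∀ {m n} {b : Bool} → (m ≡ n → b ≡ true) → (b ≡ true → m ≡ n) → (m ≡ᵇ n) ≡ b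
≡ᵇ-≡ {m} {n} {b} to from with m ≟ n
... | yes m≡n rewrite ≡ᵇ-true m≡n = sym (to m≡n)
... | no m≢n rewrite ≡ᵇ-false m≢n with b
...   | true  = ⊥-elim (m≢n (from refl))
...   | false = refl

∧-true⁻ : ∀ {a b} → (a ∧ b) ≡ true → a ≡ true × b ≡ true
∧-true⁻ {true} {true} _ = refl , refl

not-true⁻ : ∀ {b} → not b ≡ true → b ≡ false
not-true⁻ {false} _ = refl

≡not : ∀ {b c} → (b ≡ false → c ≡ true) → (c ≡ true → b ≡ false) → b ≡ not c
≡not {true}  {true}  _ c⇒¬b = c⇒¬b refl
≡not {true}  {false} _ _    = refl
≡not {false} {true}  _ _    = refl
≡not {false} {false} ¬b⇒c _ = ¬b⇒c refl

anyUpTo-true⁺ : ∀ n (p : ℕ → Bool) {j} → 1 ≤ j → j ≤ n → p j ≡ true → anyUpTo n p ≡ true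
anyUpTo-true⁺ zero    p 1≤j j≤0 _ = ⊥-elim (<⇒≱ 1≤j j≤0)
anyUpTo-true⁺ (suc n) p {j} 1≤j j≤1+n pj with p (suc n) in p[1+n]
... | true = refl
... | false with m≤n⇒m<n∨m≡n j≤1+n
...   | inj₁ j<1+n = anyUpTo-true⁺ n p 1≤j (≤-pred j<1+n) pj
...   | inj₂ refl = ⊥-elim (true≢false (trans (sym pj) p[1+n]))

anyUpTo-true⁻ : ∀ n (p : ℕ → Bool) → anyUpTo n p ≡ true → ∃ λ j → 1 ≤ j × j ≤ n × p j ≡ true
anyUpTo-true⁻ (suc n) p e with p (suc n) in p[1+n]
... | true = suc n , s≤s z≤n , ≤-refl , p[1+n]
... | false with anyUpTo-true⁻ n p e
...   | j , 1≤j , j≤n , pj = j , 1≤j , m≤n⇒m≤1+n j≤n , pj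

anyUpTo-false⁺ : ∀ n (p : ℕ → Bool) → (∀ j → 1 ≤ j → j ≤ n → p j ≡ false) → anyUpTo n p ≡ false
anyUpTo-false⁺ n p none with anyUpTo n p in e
... | false = refl
... | true with anyUpTo-true⁻ n p e
...   | j , 1≤j , j≤n , pj = trans (sym pj) (none j 1≤j j≤n)

anyUpTo-false⁻ : ∀ n (p : ℕ → Bool) → anyUpTo n p ≡ false → ∀ j → 1 ≤ j → j ≤ n → p j ≡ false
anyUpTo-false⁻ n p e j 1≤j j≤n with p j in pj
... | false = refl
... | true = trans (sym (anyUpTo-true⁺ n p 1≤j j≤n pj)) e

countUpTo-cong : ∀ n {p q : ℕ → Bool} → (∀ x → 1 ≤ x → x ≤ n → p x ≡ q x) →
                 countUpTo n p ≡ countUpTo n q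
countUpTo-cong zero    p≗q = refl
countUpTo-cong (suc n) p≗q =
  cong₂ (λ b c → ind b + c) (p≗q (suc n) (s≤s z≤n) ≤-refl)
        (countUpTo-cong n (λ x 1≤x x≤n → p≗q x 1≤x (m≤n⇒m≤1+n x≤n)))

countUpTo-+ : ∀ n {p q r : ℕ → Bool} → (∀ x → 1 ≤ x → x ≤ n → ind (p x) + ind (q x) ≡ ind (r x)) →
              countUpTo n p + countUpTo n q ≡ countUpTo n r
countUpTo-+ zero    h = refl
countUpTo-+ (suc n) {p} {q} {r} h =
  begin
    (ind (p (suc n)) + countUpTo n p) + (ind (q (suc n)) + countUpTo n q)
  ≡⟨ +-assoc-swap (ind (p (suc n))) (countUpTo n p) (ind (q (suc n))) (countUpTo n q) ⟩
    (ind (p (suc n)) + ind (q (suc n))) + (countUpTo n p + countUpTo n q)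
  ≡⟨ cong₂ _+_ (h (suc n) (s≤s z≤n) ≤-refl)
               (countUpTo-+ n (λ x 1≤x x≤n → h x 1≤x (m≤n⇒m≤1+n x≤n))) ⟩
    ind (r (suc n)) + countUpTo n r
  ∎
  where
  open ≡-Reasoning
  +-assoc-swap : ∀ a b c e → (a + b) + (c + e) ≡ (a + c) + (b + e)
  +-assoc-swap = solve-∀

countUpTo-suc : ∀ n (p : ℕ → Bool) → countUpTo (suc n) p ≡ ind (p 1) + countUpTo n (λ x → p (suc x))
countUpTo-suc zero    p = refl
countUpTo-suc (suc n) p =
  begin
    ind (p (2 + n)) + countUpTo (suc n) p
  ≡⟨ cong (ind (p (2 + n)) +_) (countUpTo-suc n p) ⟩
    ind (p (2 + n)) + (ind (p 1) + countUpTo n (λ x → p (suc x)))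
  ≡⟨ x+[y+z]≡y+[x+z] (ind (p (2 + n))) (ind (p 1)) _ ⟩
    ind (p 1) + countUpTo (suc n) (λ x → p (suc x))
  ∎
  where
  open ≡-Reasoning
  x+[y+z]≡y+[x+z] : ∀ a b c → a + (b + c) ≡ b + (a + c)
  x+[y+z]≡y+[x+z] = solve-∀

countUpTo-reverse : ∀ n (p : ℕ → Bool) → countUpTo n (λ x → p (suc n ∸ x)) ≡ countUpTo n p
countUpTo-reverse zero    p = refl
countUpTo-reverse (suc n) p =
  begin
    ind (p (2 + n ∸ suc n)) + countUpTo n (λ x → p (2 + n ∸ x))
  ≡⟨ cong₂ _+_ (cong (λ z → ind (p z)) (m+n∸n≡m 1 n))
               (countUpTo-cong n (λ x _ x≤n → cong p (+-∸-assoc 1 (m≤n⇒m≤1+n x≤n)))) ⟩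
    ind (p 1) + countUpTo n (λ x → p (suc (suc n ∸ x)))
  ≡⟨ cong (ind (p 1) +_) (countUpTo-reverse n (λ x → p (suc x))) ⟩
    ind (p 1) + countUpTo n (λ x → p (suc x))
  ≡⟨ countUpTo-suc n p ⟨
    countUpTo (suc n) p
  ∎
  where open ≡-Reasoning

countUpTo-false : ∀ n (p : ℕ → Bool) → (∀ x → 1 ≤ x → x ≤ n → p x ≡ false) → countUpTo n p ≡ 0
countUpTo-false zero    p none = refl
countUpTo-false (suc n) p none rewrite none (suc n) (s≤s z≤n) ≤-refl =
  countUpTo-false n p (λ x 1≤x x≤n → none x 1≤x (m≤n⇒m≤1+n x≤n))

countUpTo-unique : ∀ n (p : ℕ → Bool) {m} → 1 ≤ m → m ≤ n → p m ≡ true →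
                   (∀ x → 1 ≤ x → x ≤ n → x ≢ m → p x ≡ false) → countUpTo n p ≡ 1
countUpTo-unique zero    p 1≤m m≤0 _ _ = ⊥-elim (<⇒≱ 1≤m m≤0)
countUpTo-unique (suc n) p {m} 1≤m m≤1+n pm others with m≤n⇒m<n∨m≡n m≤1+n
... | inj₁ m<1+n rewrite others (suc n) (s≤s z≤n) ≤-refl (>⇒≢ m<1+n) =
  countUpTo-unique n p 1≤m (≤-pred m<1+n) pm (λ x 1≤x x≤n → others x 1≤x (m≤n⇒m≤1+n x≤n))
... | inj₂ refl rewrite pm =
  cong suc (countUpTo-false n p (λ x 1≤x x≤n → others x 1≤x (m≤n⇒m≤1+n x≤n) (<⇒≢ (s≤s x≤n))))

countUpTo-true : ∀ n → countUpTo n (λ _ → true) ≡ n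
countUpTo-true zero    = refl
countUpTo-true (suc n) = cong suc (countUpTo-true n)

countUpTo-not : ∀ n (p : ℕ → Bool) → countUpTo n p + countUpTo n (λ x → not (p x)) ≡ n
countUpTo-not n p = trans (countUpTo-+ n (λ x _ _ → ind-not (p x))) (countUpTo-true n)

greatestUpTo : (p : ℕ → Bool) → ∀ n {x} → x ≤ n → p x ≡ true →
               ∃ λ e → x ≤ e × e ≤ n × p e ≡ true × (∀ y → e < y → y ≤ n → p y ≡ false)
greatestUpTo p zero    z≤n px = zero , z≤n , z≤n , px , λ y 0<y y≤0 → ⊥-elim (<⇒≱ 0<y y≤0)
greatestUpTo p (suc n) {x} x≤1+n px with p (suc n) in p[1+n]
... | true = suc n , x≤1+n , ≤-refl , p[1+n] , λ y 1+n<y y≤1+n → ⊥-elim (<⇒≱ 1+n<y y≤1+n)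
... | false with m≤n⇒m<n∨m≡n x≤1+n
...   | inj₂ refl = ⊥-elim (true≢false (trans (sym px) p[1+n]))
...   | inj₁ x<1+n with greatestUpTo p n (≤-pred x<1+n) px
...     | e , x≤e , e≤n , pe , above = e , x≤e , m≤n⇒m≤1+n e≤n , pe , above′
  where
  above′ : ∀ y → e < y → y ≤ suc n → p y ≡ false
  above′ y e<y y≤1+n with m≤n⇒m<n∨m≡n y≤1+n
  ... | inj₁ y<1+n = above y e<y (≤-pred y<1+n)
  ... | inj₂ refl = p[1+n]

leastUpTo : (p : ℕ → Bool) → ∀ n → anyUpTo n p ≡ true →
            ∃ λ m → 1 ≤ m × m ≤ n × p m ≡ true × (∀ y → 1 ≤ y → y < m → p y ≡ false)
leastUpTo p (suc n) e with anyUpTo n p in below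
... | true with leastUpTo p n below
...   | m , 1≤m , m≤n , pm , least = m , 1≤m , m≤n⇒m≤1+n m≤n , pm , least
leastUpTo p (suc n) e | false with p (suc n) in p[1+n]
... | true = suc n , s≤s z≤n , ≤-refl , p[1+n] ,
             λ y 1≤y y<1+n → anyUpTo-false⁻ n p below y 1≤y (≤-pred y<1+n)

-- The primed point on the arc from g to next d g: the paper's (d - g)', with 0' read as d'.

gapAfter : ℕ → ℕ → ℕ
gapAfter d g = if g ≡ᵇ d then d else d ∸ g

gapAfter-last : ∀ d → gapAfter d d ≡ d
gapAfter-last d rewrite ≡ᵇ-refl d = refl

gapAfter-< : ∀ {d g} → g < d → gapAfter d g ≡ d ∸ g
gapAfter-< {d} {g} g<d rewrite ≡ᵇ-false (<⇒≢ g<d) = refl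

gapAfter-range : ∀ {d g} → 1 ≤ g → g ≤ d → 1 ≤ gapAfter d g × gapAfter d g ≤ d
gapAfter-range {d} {g} 1≤g g≤d with m≤n⇒m<n∨m≡n g≤d
... | inj₁ g<d rewrite gapAfter-< g<d = m<n⇒0<n∸m g<d , m∸n≤m d g
... | inj₂ refl rewrite gapAfter-last g = 1≤g , ≤-refl

gapAfter-involutive : ∀ {d g} → 1 ≤ g → g ≤ d → gapAfter d (gapAfter d g) ≡ g
gapAfter-involutive {d} {g} 1≤g g≤d with m≤n⇒m<n∨m≡n g≤d
... | inj₁ g<d rewrite gapAfter-< g<d =
  trans (gapAfter-< (∸-monoʳ-< 1≤g g≤d)) (m∸[m∸n]≡n g≤d)
... | inj₂ refl rewrite gapAfter-last g = gapAfter-last g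

gapAfter-injective : ∀ {d g h} → 1 ≤ g → g ≤ d → 1 ≤ h → h ≤ d → gapAfter d g ≡ gapAfter d h → g ≡ h
gapAfter-injective {d} 1≤g g≤d 1≤h h≤d eq =
  trans (sym (gapAfter-involutive 1≤g g≤d)) (trans (cong (gapAfter d) eq) (gapAfter-involutive 1≤h h≤d))

countUpTo-gapAfter : ∀ d (p : ℕ → Bool) → countUpTo d (λ g → p (gapAfter d g)) ≡ countUpTo d p
countUpTo-gapAfter zero    p = refl
countUpTo-gapAfter (suc n) p =
  cong₂ _+_ (cong (λ z → ind (p z)) (gapAfter-last (suc n)))
            (trans (countUpTo-cong n (λ x _ x≤n → cong p (gapAfter-< (s≤s x≤n)))) (countUpTo-reverse n p))

next-< : ∀ {d g} → g < d → next d g ≡ suc g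
next-< {d} {g} g<d rewrite ≡ᵇ-false (<⇒≢ g<d) = refl

next-last : ∀ d → next d d ≡ 1
next-last d rewrite ≡ᵇ-refl d = refl

next-gapAfter : ∀ {d k} → 1 ≤ k → k < d → next d (gapAfter d (suc k)) ≡ gapAfter d k
next-gapAfter {d} {k} 1≤k k<d rewrite gapAfter-< k<d with m≤n⇒m<n∨m≡n k<d
... | inj₁ 1+k<d rewrite gapAfter-< 1+k<d | next-< (∸-monoʳ-< {d} {suc k} {0} (s≤s z≤n) (<⇒≤ 1+k<d)) =
  sym (+-∸-assoc 1 (<⇒≤ 1+k<d))
... | inj₂ refl rewrite gapAfter-last (suc k) | next-last (suc k) = sym (m+n∸n≡m 1 k)

next-gapAfter-first : ∀ {d} → 1 < d → next d (gapAfter d 1) ≡ gapAfter d d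
next-gapAfter-first {d} 1<d
  rewrite gapAfter-< 1<d | gapAfter-last d | next-< (∸-monoʳ-< {d} {1} {0} ≤-refl (<⇒≤ 1<d)) =
  sym (+-∸-assoc 1 (<⇒≤ 1<d))

countUpTo-next : ∀ d (p : ℕ → Bool) → countUpTo d (λ g → p (next d g)) ≡ countUpTo d p
countUpTo-next zero    p = refl
countUpTo-next (suc n) p =
  trans (cong₂ _+_ (cong (λ z → ind (p z)) (next-last (suc n)))
                   (countUpTo-cong n (λ x _ x≤n → cong p (next-< (s≤s x≤n)))))
        (sym (countUpTo-suc n p))

-- The point g sits at position 2g - 2 and the primed point gapAfter d g at 2g - 1.

posU-suc : ∀ a → posU (suc a) ≡ 2 * a
posU-suc a = cong (_∸ 2) (*-suc 2 a)

posP-gapAfter : ∀ {d g} → suc g ≤ d → posP d (gapAfter d (suc g)) ≡ suc (2 * g)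
posP-gapAfter {d} {g} 1+g≤d with m≤n⇒m<n∨m≡n 1+g≤d
... | inj₂ refl rewrite gapAfter-last (suc g) | ≡ᵇ-refl (suc g) = cong (_∸ 1) (*-suc 2 g)
... | inj₁ 1+g<d
  rewrite gapAfter-< 1+g<d | ≡ᵇ-false (<⇒≢ (∸-monoʳ-< {d} {suc g} {0} (s≤s z≤n) (<⇒≤ 1+g<d)))
        | m∸[m∸n]≡n {d} {suc g} (<⇒≤ 1+g<d) = cong (_∸ 1) (*-suc 2 g)

point<gap : ∀ {d a b} → 1 ≤ a → a ≤ b → b ≤ d → posU a < posP d (gapAfter d b)
point<gap {a = suc a} {suc b} _ a≤b b≤d =
  subst₂ _<_ (sym (posU-suc a)) (sym (posP-gapAfter b≤d)) (s≤s (*-monoʳ-≤ 2 (≤-pred a≤b)))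

point<gap⁻ : ∀ {d a b} → 1 ≤ a → 1 ≤ b → b ≤ d → posU a < posP d (gapAfter d b) → a ≤ b
point<gap⁻ {a = suc a} {suc b} _ _ b≤d a<b =
  s≤s (*-cancelˡ-≤ 2 (≤-pred (subst₂ _<_ (posU-suc a) (posP-gapAfter b≤d) a<b)))

gap<point : ∀ {d a b} → 1 ≤ a → a ≤ d → a < b → posP d (gapAfter d a) < posU b
gap<point {a = suc a} {suc b} _ a≤d a<b =
  subst₂ _<_ (sym (posP-gapAfter a≤d)) (sym (posU-suc b))
         (subst (_≤ 2 * b) (*-suc 2 a) (*-monoʳ-≤ 2 (≤-pred a<b)))

gap<point⁻ : ∀ {d a b} → 1 ≤ a → a ≤ d → 1 ≤ b → posP d (gapAfter d a) < posU b → a < b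
gap<point⁻ {a = suc a} {suc b} _ a≤d _ a<b =
  s≤s (*-cancelˡ-≤ 2 (subst (_≤ 2 * b) (sym (*-suc 2 a)) (subst₂ _<_ (posP-gapAfter a≤d) (posU-suc b) a<b)))

gap<gap⁻ : ∀ {d a b} → 1 ≤ a → a ≤ d → 1 ≤ b → b ≤ d → posP d (gapAfter d a) < posP d (gapAfter d b) → a < b
gap<gap⁻ {a = suc a} {suc b} _ a≤d _ b≤d a<b =
  s≤s (*-cancelˡ-< 2 a b (≤-pred (subst₂ _<_ (posP-gapAfter a≤d) (posP-gapAfter b≤d) a<b)))

isSingleton-true⁺ : ∀ {d f k} → (∀ j → 1 ≤ j → j ≤ d → f j ≡ f k → j ≡ k) → isSingleton d f k ≡ true
isSingleton-true⁺ {d} {f} {k} alone =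
  cong not (anyUpTo-false⁺ d _ λ j 1≤j j≤d → other-false j (alone j 1≤j j≤d))
  where
  other-false : ∀ j → (f j ≡ f k → j ≡ k) → (not (j ≡ᵇ k) ∧ sameB f j k) ≡ false
  other-false j same⇒≡ with f j ≟ f k
  ... | yes fj≡fk rewrite ≡ᵇ-true (same⇒≡ fj≡fk) = refl
  ... | no fj≢fk rewrite ≡ᵇ-false fj≢fk = ∧-zeroʳ (not (j ≡ᵇ k))

isSingleton-false⁺ : ∀ {d f k j} → 1 ≤ j → j ≤ d → j ≢ k → f j ≡ f k → isSingleton d f k ≡ false
isSingleton-false⁺ {d} {f} {k} {j} 1≤j j≤d j≢k fj≡fk =
  cong not (anyUpTo-true⁺ d (λ j → not (j ≡ᵇ k) ∧ sameB f j k) 1≤j j≤d other)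
  where
  other : (not (j ≡ᵇ k) ∧ sameB f j k) ≡ true
  other rewrite ≡ᵇ-false j≢k | ≡ᵇ-true fj≡fk = refl

isSingleton-true⁻ : ∀ {d f k} → isSingleton d f k ≡ true → ∀ j → 1 ≤ j → j ≤ d → f j ≡ f k → j ≡ k
isSingleton-true⁻ {k = k} single j 1≤j j≤d fj≡fk with j ≟ k
... | yes j≡k = j≡k
... | no j≢k = ⊥-elim (true≢false (trans (sym single) (isSingleton-false⁺ 1≤j j≤d j≢k fj≡fk)))

isBlockMin : (ℕ → ℕ) → ℕ → Bool
isBlockMin f k = not (anyUpTo (k ∸ 1) (λ j → sameB f j k))

isBlockMin-true⁺ : ∀ {f k} → (∀ j → 1 ≤ j → j < k → f j ≢ f k) → isBlockMin f k ≡ true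
isBlockMin-true⁺ {f} {k} none =
  cong not (anyUpTo-false⁺ (k ∸ 1) _ λ j 1≤j j≤k-1 → ≡ᵇ-false (none j 1≤j (≤pred⇒< 1≤j j≤k-1)))
  where
  ≤pred⇒< : ∀ {j k} → 1 ≤ j → j ≤ k ∸ 1 → j < k
  ≤pred⇒< {k = zero}  1≤j j≤0   = ⊥-elim (<⇒≱ 1≤j j≤0)
  ≤pred⇒< {k = suc k} _   j≤k   = s≤s j≤k

isBlockMin-false⁺ : ∀ {f k j} → 1 ≤ j → j < k → f j ≡ f k → isBlockMin f k ≡ false
isBlockMin-false⁺ {f} {suc k} 1≤j j<1+k fj≡fk
  rewrite anyUpTo-true⁺ k (λ j → sameB f j (suc k)) 1≤j (≤-pred j<1+k) (≡ᵇ-true fj≡fk) = refl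

isBlockMin-true⁻ : ∀ {f k} → isBlockMin f k ≡ true → ∀ j → 1 ≤ j → j < k → f j ≢ f k
isBlockMin-true⁻ least j 1≤j j<k fj≡fk = true≢false (trans (sym least) (isBlockMin-false⁺ 1≤j j<k fj≡fk))

isBlockMin-false⁻ : ∀ {f k} → isBlockMin f k ≡ false → ∃ λ j → 1 ≤ j × j < k × f j ≡ f k
isBlockMin-false⁻ {f} {suc k} not-least with anyUpTo k (λ j → sameB f j (suc k)) in some
... | true with anyUpTo-true⁻ k _ some
...   | j , 1≤j , j≤k , fj≡fk = j , 1≤j , s≤s j≤k , ≡ᵇ-true⁻ fj≡fk

blocks+singletons : ∀ d f → block d f + countUpTo d (isSingleton d f) ≡ countUpTo d (isBlockMin f)
blocks+singletons d f = countUpTo-+ d per-point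
  where
  per-point : ∀ k → 1 ≤ k → k ≤ d →
              ind (isMinOfBigBlock d f k) + ind (isSingleton d f k) ≡ ind (isBlockMin f k)
  per-point k 1≤k k≤d with anyUpTo d (λ j → not (j ≡ᵇ k) ∧ sameB f j k) in others
  ... | true  = trans (+-identityʳ _) (cong ind (∧-identityʳ (isBlockMin f k)))
  ... | false = trans (cong (λ b → ind b + 1) (∧-zeroʳ (isBlockMin f k)))
                      (cong ind (sym (isBlockMin-true⁺ {f} {k} least)))
    where
    least : ∀ j → 1 ≤ j → j < k → f j ≢ f k
    least j 1≤j j<k fj≡fk =
      <⇒≢ j<k (isSingleton-true⁻ {d} {f} (cong not others) j 1≤j (≤-trans (<⇒≤ j<k) k≤d) fj≡fk)

identify : ℕ → ℕ → ℕ → ℕ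
identify p q i = if i ≡ᵇ q then p else i

identify-≡ : ∀ {p q i j} → identify p q i ≡ identify p q j →
             i ≡ j ⊎ (i ≡ q × j ≡ p) ⊎ (i ≡ p × j ≡ q)
identify-≡ {p} {q} {i} {j} eq with i ≡ᵇ q in i≡q | j ≡ᵇ q in j≡q
... | true  | true  = inj₁ (trans (≡ᵇ-true⁻ i≡q) (sym (≡ᵇ-true⁻ j≡q)))
... | true  | false = inj₂ (inj₁ (≡ᵇ-true⁻ i≡q , sym eq))
... | false | true  = inj₂ (inj₂ (eq , ≡ᵇ-true⁻ j≡q))
... | false | false = inj₁ eq

identify-merges : ∀ p q → identify p q p ≡ identify p q q
identify-merges p q rewrite ≡ᵇ-refl q with p ≡ᵇ q
... | true  = refl
... | false = refl

identify-isNC : ∀ d p q → IsNC d (identify p q)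
identify-isNC d p q a b c e _ a<b b<c c<e _ τa≡τc τb≡τe
  with identify-≡ τa≡τc | identify-≡ τb≡τe
... | inj₁ a≡c | _ = ⊥-elim (<⇒≢ (<-trans a<b b<c) a≡c)
... | inj₂ _ | inj₁ b≡e = ⊥-elim (<⇒≢ (<-trans b<c c<e) b≡e)
... | inj₂ (inj₁ (refl , refl)) | inj₂ (inj₁ (refl , _)) = ⊥-elim (<-irrefl refl a<b)
... | inj₂ (inj₁ (refl , refl)) | inj₂ (inj₂ (refl , _)) = ⊥-elim (<-irrefl refl b<c)
... | inj₂ (inj₂ (refl , refl)) | inj₂ (inj₁ (refl , _)) = ⊥-elim (<-irrefl refl b<c)
... | inj₂ (inj₂ (refl , refl)) | inj₂ (inj₂ (refl , _)) = ⊥-elim (<-irrefl refl a<b)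

ArcClosed : ℕ → (ℕ → ℕ) → ℕ → ℕ → Set
ArcClosed d π a b = ∀ y z → a ≤ y → y ≤ b → 1 ≤ z → z ≤ d → (z < a ⊎ b < z) → π y ≢ π z

singleton⇒closed : ∀ {d π k} → 1 ≤ k → k ≤ d → isSingleton d π k ≡ true → ArcClosed d π k k
singleton⇒closed {π = π} 1≤k k≤d single y z k≤y y≤k 1≤z z≤d z-outside πy≡πz
  with ≤-antisym y≤k k≤y | z-outside
... | refl | inj₁ z<y = <⇒≢ z<y (isSingleton-true⁻ {f = π} single z 1≤z z≤d (sym πy≡πz))
... | refl | inj₂ y<z = >⇒≢ y<z (isSingleton-true⁻ {f = π} single z 1≤z z≤d (sym πy≡πz))

closed⇒singleton : ∀ {d π k} → ArcClosed d π k k → isSingleton d π k ≡ true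
closed⇒singleton {d} {π} {k} closed = isSingleton-true⁺ other
  where
  other : ∀ j → 1 ≤ j → j ≤ d → π j ≡ π k → j ≡ k
  other j 1≤j j≤d πj≡πk with <-cmp j k
  ... | tri< j<k _ _ = ⊥-elim (closed k j ≤-refl ≤-refl 1≤j j≤d (inj₁ j<k) (sym πj≡πk))
  ... | tri≈ _ j≡k _ = j≡k
  ... | tri> _ _ k<j = ⊥-elim (closed k j ≤-refl ≤-refl 1≤j j≤d (inj₂ k<j) (sym πj≡πk))

first-singleton⇒closed : ∀ {d π} → isSingleton d π 1 ≡ true → ArcClosed d π 2 d
first-singleton⇒closed {π = π} single y z 2≤y y≤d 1≤z z≤d (inj₁ z<2) πy≡πz
  with ≤-antisym (≤-pred z<2) 1≤z
... | refl = >⇒≢ 2≤y (isSingleton-true⁻ {f = π} single y (≤-trans (s≤s z≤n) 2≤y) y≤d πy≡πz)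
first-singleton⇒closed single y z 2≤y y≤d 1≤z z≤d (inj₂ d<z) πy≡πz = <⇒≱ d<z z≤d

closed⇒first-singleton : ∀ {d π} → ArcClosed d π 2 d → isSingleton d π 1 ≡ true
closed⇒first-singleton {d} {π} closed = isSingleton-true⁺ other
  where
  other : ∀ j → 1 ≤ j → j ≤ d → π j ≡ π 1 → j ≡ 1
  other (suc zero) _ _ _ = refl
  other (suc (suc j)) _ j≤d πj≡π1 =
    ⊥-elim (closed (2 + j) 1 (s≤s (s≤s z≤n)) j≤d ≤-refl (≤-trans (s≤s z≤n) j≤d) (inj₁ ≤-refl) πj≡π1)

module ClosedArcs {d : ℕ} {π : ℕ → ℕ} (π-nc : IsNC d π) where

  blockSpan-closed : ∀ {m e} → 1 ≤ m → m ≤ e → e ≤ d → π m ≡ π e →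
                     (∀ z → 1 ≤ z → z < m → π z ≢ π m) → (∀ z → e < z → z ≤ d → π z ≢ π m) →
                     ArcClosed d π m e
  blockSpan-closed {m} {e} 1≤m m≤e e≤d πm≡πe below above y z m≤y y≤e 1≤z z≤d z-outside πy≡πz
    with π y ≟ π m | z-outside
  ... | yes πy≡πm | inj₁ z<m = below z 1≤z z<m (trans (sym πy≡πz) πy≡πm)
  ... | yes πy≡πm | inj₂ e<z = above z e<z z≤d (trans (sym πy≡πz) πy≡πm)
  ... | no πy≢πm | inj₁ z<m = πy≢πm (trans πy≡πz (π-nc z m y e 1≤z z<m m<y y<e e≤d (sym πy≡πz) πm≡πe))
    where
    m<y = ≤∧≢⇒< m≤y (λ m≡y → πy≢πm (cong π (sym m≡y)))
    y<e = ≤∧≢⇒< y≤e (λ y≡e → πy≢πm (trans (cong π y≡e) (sym πm≡πe)))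
  ... | no πy≢πm | inj₂ e<z = πy≢πm (sym (π-nc m y e z 1≤m m<y y<e e<z z≤d πm≡πe πy≡πz))
    where
    m<y = ≤∧≢⇒< m≤y (λ m≡y → πy≢πm (cong π (sym m≡y)))
    y<e = ≤∧≢⇒< y≤e (λ y≡e → πy≢πm (trans (cong π y≡e) (sym πm≡πe)))

  between-closed : ∀ {e g} → 1 ≤ e → e < g → g < d → π e ≡ π (suc g) →
                   (∀ y → e < y → y ≤ g → π y ≢ π (suc g)) → ArcClosed d π (suc e) g
  between-closed {e} {g} 1≤e e<g g<d πe≡πg' none y z e<y y≤g 1≤z z≤d z-outside πy≡πz =
    none y e<y y≤g (πy≡πg' z-outside)
    where
    πy≡πg' : z < suc e ⊎ g < z → π y ≡ π (suc g)
    πy≡πg' (inj₁ z≤e) with m≤n⇒m<n∨m≡n (≤-pred z≤e)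
    ... | inj₁ z<e =
      trans πy≡πz (trans (π-nc z e y (suc g) 1≤z z<e e<y (s≤s y≤g) g<d (sym πy≡πz) πe≡πg') πe≡πg')
    ... | inj₂ refl = trans πy≡πz πe≡πg'
    πy≡πg' (inj₂ g<z) with m≤n⇒m<n∨m≡n g<z
    ... | inj₁ g'<z = trans (sym (π-nc e y (suc g) z 1≤e e<y (s≤s y≤g) g'<z z≤d πe≡πg' πy≡πz)) πe≡πg'
    ... | inj₂ refl = πy≡πz

  complement-closed : ∀ {e} → ArcClosed d π 1 e → ArcClosed d π (suc e) d
  complement-closed closed y z e<y y≤d 1≤z z≤d (inj₁ z≤e) πy≡πz =
    closed z y 1≤z (≤-pred z≤e) (≤-trans (s≤s z≤n) e<y) y≤d (inj₂ e<y) (sym πy≡πz)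
  complement-closed closed y z e<y y≤d 1≤z z≤d (inj₂ d<z) πy≡πz = <⇒≱ d<z z≤d

module Complement {d : ℕ} {π σ : ℕ → ℕ} (π-nc : IsNC d π) (σ-α : IsAlpha d π σ) where

  open ClosedArcs π-nc

  compatible : Compatible d π σ
  compatible = proj₁ (proj₂ σ-α)

  coarsest : ∀ τ → IsNC d τ → Compatible d π τ →
             ∀ i j → 1 ≤ i → i ≤ d → 1 ≤ j → j ≤ d → τ i ≡ τ j → σ i ≡ σ j
  coarsest = proj₂ (proj₂ σ-α)

  blocks-uncrossed₁ : ∀ {a c g h} → 1 ≤ a → a ≤ g → g < c → c ≤ h → h ≤ d →
                      π a ≡ π c → σ (gapAfter d g) ≡ σ (gapAfter d h) → ⊥
  blocks-uncrossed₁ {a} {c} {g} {h} 1≤a a≤g g<c c≤h h≤d πa≡πc σg≡σh =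
    proj₁ (compatible a c (gapAfter d g) (gapAfter d h) 1≤a (≤-trans a≤g g≤d) 1≤c (≤-trans c≤h h≤d)
                      (proj₁ g-range) (proj₂ g-range) (proj₁ h-range) (proj₂ h-range) πa≡πc σg≡σh)
          (point<gap 1≤a a≤g g≤d) (gap<point 1≤g g≤d g<c) (point<gap 1≤c c≤h h≤d)
    where
    1≤g = ≤-trans 1≤a a≤g
    1≤c = ≤-trans (s≤s z≤n) g<c
    g≤d = ≤-trans (<⇒≤ g<c) (≤-trans c≤h h≤d)
    g-range = gapAfter-range 1≤g g≤d
    h-range = gapAfter-range (≤-trans 1≤c c≤h) h≤d

  blocks-uncrossed₂ : ∀ {a c g h} → 1 ≤ g → g < a → a ≤ h → h < c → c ≤ d →
                      π a ≡ π c → σ (gapAfter d g) ≡ σ (gapAfter d h) → ⊥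
  blocks-uncrossed₂ {a} {c} {g} {h} 1≤g g<a a≤h h<c c≤d πa≡πc σg≡σh =
    proj₂ (compatible a c (gapAfter d g) (gapAfter d h) 1≤a a≤d (≤-trans (s≤s z≤n) h<c) c≤d
                      (proj₁ g-range) (proj₂ g-range) (proj₁ h-range) (proj₂ h-range) πa≡πc σg≡σh)
          (gap<point 1≤g g≤d g<a) (point<gap 1≤a a≤h h≤d) (gap<point 1≤h h≤d h<c)
    where
    1≤a = ≤-trans (s≤s z≤n) g<a
    1≤h = ≤-trans 1≤a a≤h
    h≤d = <⇒≤ (<-≤-trans h<c c≤d)
    a≤d = ≤-trans a≤h h≤d
    g≤d = ≤-trans (<⇒≤ g<a) a≤d
    g-range = gapAfter-range 1≤g g≤d
    h-range = gapAfter-range 1≤h h≤d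

  gap-block⇒arcClosed : ∀ {g h} → 1 ≤ g → g < h → h ≤ d →
                        σ (gapAfter d g) ≡ σ (gapAfter d h) → ArcClosed d π (suc g) h
  gap-block⇒arcClosed 1≤g g<h h≤d σg≡σh y z g<y y≤h 1≤z z≤d (inj₁ z≤g) πy≡πz =
    blocks-uncrossed₁ 1≤z (≤-pred z≤g) g<y y≤h h≤d (sym πy≡πz) σg≡σh
  gap-block⇒arcClosed 1≤g g<h h≤d σg≡σh y z g<y y≤h 1≤z z≤d (inj₂ h<z) πy≡πz =
    blocks-uncrossed₂ 1≤g g<y y≤h h<z z≤d πy≡πz σg≡σh

  identify-compatible : ∀ {g h} → 1 ≤ g → g < h → h ≤ d → ArcClosed d π (suc g) h →
                        Compatible d π (identify (gapAfter d g) (gapAfter d h))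
  identify-compatible {g} {h} 1≤g g<h h≤d closed a c b e 1≤a a≤d 1≤c c≤d _ _ _ _ πa≡πc τb≡τe
    with identify-≡ {gapAfter d g} {gapAfter d h} {b} {e} τb≡τe
  ... | inj₁ refl =
    (λ _ b<c c<b → <-irrefl refl (<-trans b<c c<b)) , (λ b<a a<b _ → <-irrefl refl (<-trans b<a a<b))
  ... | inj₂ (inj₁ (refl , refl)) =
    (λ _ b<c c<e → h≮g (<-trans b<c c<e)) , (λ b<a a<e _ → h≮g (<-trans b<a a<e))
    where
    h≮g : posP d (gapAfter d h) < posP d (gapAfter d g) → ⊥
    h≮g h<g = <-asym g<h (gap<gap⁻ (≤-trans 1≤g (<⇒≤ g<h)) h≤d 1≤g (<⇒≤ (<-≤-trans g<h h≤d)) h<g)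
  ... | inj₂ (inj₂ (refl , refl)) =
    (λ a<b b<c c<e → closed c a (gap<point⁻ 1≤g g≤d 1≤c b<c) (point<gap⁻ 1≤c 1≤h h≤d c<e) 1≤a a≤d
                            (inj₁ (s≤s (point<gap⁻ 1≤a 1≤g g≤d a<b))) (sym πa≡πc)) ,
    (λ b<a a<e e<c → closed a c (gap<point⁻ 1≤g g≤d 1≤a b<a) (point<gap⁻ 1≤a 1≤h h≤d a<e) 1≤c c≤d
                            (inj₂ (gap<point⁻ 1≤h h≤d 1≤c e<c)) πa≡πc)
    where
    g≤d = <⇒≤ (<-≤-trans g<h h≤d)
    1≤h = ≤-trans 1≤g (<⇒≤ g<h)

  arcClosed⇒gap-block : ∀ {g h} → 1 ≤ g → g < h → h ≤ d →
                        ArcClosed d π (suc g) h → σ (gapAfter d g) ≡ σ (gapAfter d h)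
  arcClosed⇒gap-block {g} {h} 1≤g g<h h≤d closed =
    coarsest (identify (gapAfter d g) (gapAfter d h)) (identify-isNC d _ _)
             (identify-compatible 1≤g g<h h≤d closed)
             (gapAfter d g) (gapAfter d h) (proj₁ g-range) (proj₂ g-range) (proj₁ h-range) (proj₂ h-range)
             (identify-merges (gapAfter d g) (gapAfter d h))
    where
    g-range = gapAfter-range 1≤g (<⇒≤ (<-≤-trans g<h h≤d))
    h-range = gapAfter-range (≤-trans 1≤g (<⇒≤ g<h)) h≤d

  gap-partner⇒notAnti : ∀ {g h} → 1 ≤ g → g ≤ d → 1 ≤ h → h ≤ d → h ≢ g →
                        σ (gapAfter d h) ≡ σ (gapAfter d g) → π g ≢ π (next d g)
  gap-partner⇒notAnti {g} {h} 1≤g g≤d 1≤h h≤d h≢g σh≡σg with <-cmp h g | m≤n⇒m<n∨m≡n g≤d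
  ... | tri≈ _ h≡g _ | _ = ⊥-elim (h≢g h≡g)
  ... | tri< h<g _ _ | inj₁ g<d rewrite next-< g<d =
    gap-block⇒arcClosed 1≤h h<g g≤d σh≡σg g (suc g) h<g ≤-refl (s≤s z≤n) g<d (inj₂ ≤-refl)
  ... | tri< h<g _ _ | inj₂ refl rewrite next-last g =
    gap-block⇒arcClosed 1≤h h<g g≤d σh≡σg g 1 h<g ≤-refl ≤-refl 1≤g (inj₁ (s≤s 1≤h))
  ... | tri> _ _ g<h | _ rewrite next-< (<-≤-trans g<h h≤d) = λ πg≡πg' →
    gap-block⇒arcClosed 1≤g g<h h≤d (sym σh≡σg) (suc g) g ≤-refl g<h 1≤g g≤d (inj₁ ≤-refl) (sym πg≡πg')

  -- The partner is the predecessor of suc g in its block.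
  partner-below : ∀ {g x} → g < d → 1 ≤ x → x ≤ g → π x ≡ π (suc g) → π g ≢ π (suc g) →
                  ∃ λ h → 1 ≤ h × h ≤ d × h ≢ g × σ (gapAfter d h) ≡ σ (gapAfter d g)
  partner-below {g} {x} g<d 1≤x x≤g πx≡πg' πg≢πg'
    with greatestUpTo (λ y → π y ≡ᵇ π (suc g)) g x≤g (≡ᵇ-true πx≡πg')
  ... | e , x≤e , e≤g , πe≡πg' , above =
    e , 1≤e , <⇒≤ (<-trans e<g g<d) , <⇒≢ e<g ,
    arcClosed⇒gap-block 1≤e e<g (<⇒≤ g<d)
      (between-closed 1≤e e<g g<d (≡ᵇ-true⁻ πe≡πg') λ y e<y y≤g → ≡ᵇ-false⁻ (above y e<y y≤g))
    where
    1≤e = ≤-trans 1≤x x≤e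
    e<g = ≤∧≢⇒< e≤g (λ e≡g → πg≢πg' (subst (λ w → π w ≡ π (suc g)) e≡g (≡ᵇ-true⁻ πe≡πg')))

  -- suc g is the least element of its block; its partner is the greatest.
  partner-above : ∀ {g} → 1 ≤ g → g < d → (∀ y → 1 ≤ y → y ≤ g → π y ≢ π (suc g)) →
                  ∃ λ h → 1 ≤ h × h ≤ d × h ≢ g × σ (gapAfter d h) ≡ σ (gapAfter d g)
  partner-above {g} 1≤g g<d none
    with greatestUpTo (λ y → π y ≡ᵇ π (suc g)) d g<d (≡ᵇ-refl (π (suc g)))
  ... | e , g<e , e≤d , πe≡πg' , above =
    e , ≤-trans (s≤s z≤n) g<e , e≤d , >⇒≢ g<e ,
    sym (arcClosed⇒gap-block 1≤g g<e e≤d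
          (blockSpan-closed (s≤s z≤n) g<e e≤d (sym (≡ᵇ-true⁻ πe≡πg'))
            (λ z 1≤z z<g' → none z 1≤z (≤-pred z<g')) λ z e<z z≤d → ≡ᵇ-false⁻ (above z e<z z≤d)))

  partner-of-last : π d ≢ π 1 → 1 ≤ d →
                    ∃ λ h → 1 ≤ h × h ≤ d × h ≢ d × σ (gapAfter d h) ≡ σ (gapAfter d d)
  partner-of-last πd≢π1 1≤d with greatestUpTo (λ y → π y ≡ᵇ π 1) d 1≤d (≡ᵇ-refl (π 1))
  ... | e , 1≤e , e≤d , πe≡π1 , above =
    e , 1≤e , e≤d , <⇒≢ e<d ,
    arcClosed⇒gap-block 1≤e e<d ≤-refl
      (complement-closed (blockSpan-closed ≤-refl 1≤e e≤d (sym (≡ᵇ-true⁻ πe≡π1))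
        (λ z 1≤z z<1 → ⊥-elim (<⇒≱ z<1 1≤z)) λ z e<z z≤d → ≡ᵇ-false⁻ (above z e<z z≤d)))
    where
    e<d = ≤∧≢⇒< e≤d (λ e≡d → πd≢π1 (subst (λ w → π w ≡ π 1) e≡d (≡ᵇ-true⁻ πe≡π1)))

  notAnti⇒gap-partner : ∀ {g} → 1 ≤ g → g ≤ d → π g ≢ π (next d g) →
                        ∃ λ h → 1 ≤ h × h ≤ d × h ≢ g × σ (gapAfter d h) ≡ σ (gapAfter d g)
  notAnti⇒gap-partner {g} 1≤g g≤d πg≢πg' with m≤n⇒m<n∨m≡n g≤d
  ... | inj₂ refl = partner-of-last (subst (π g ≢_) (cong π (next-last g)) πg≢πg') 1≤g
  ... | inj₁ g<d with anyUpTo g (λ y → π y ≡ᵇ π (suc g)) in found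
  ...   | true with anyUpTo-true⁻ g _ found
  ...     | x , 1≤x , x≤g , πx≡πg' =
    partner-below g<d 1≤x x≤g (≡ᵇ-true⁻ πx≡πg') (subst (π g ≢_) (cong π (next-< g<d)) πg≢πg')
  notAnti⇒gap-partner {g} 1≤g g≤d πg≢πg' | inj₁ g<d | false =
    partner-above 1≤g g<d λ y 1≤y y≤g → ≡ᵇ-false⁻ (anyUpTo-false⁻ g _ found y 1≤y y≤g)

  gap-singleton≡antisingleton : ∀ {g} → 1 ≤ g → g ≤ d → isSingleton d σ (gapAfter d g) ≡ isAnti d π g
  gap-singleton≡antisingleton {g} 1≤g g≤d with π g ≟ π (next d g)
  ... | yes πg≡πg' rewrite ≡ᵇ-true πg≡πg' = isSingleton-true⁺ alone
    where
    alone : ∀ j → 1 ≤ j → j ≤ d → σ j ≡ σ (gapAfter d g) → j ≡ gapAfter d g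
    alone j 1≤j j≤d σj≡σg with gapAfter d j ≟ g
    ... | yes h≡g = trans (sym (gapAfter-involutive 1≤j j≤d)) (cong (gapAfter d) h≡g)
    ... | no h≢g = ⊥-elim (gap-partner⇒notAnti 1≤g g≤d (proj₁ h-range) (proj₂ h-range) h≢g
                             (trans (cong σ (gapAfter-involutive 1≤j j≤d)) σj≡σg) πg≡πg')
      where h-range = gapAfter-range 1≤j j≤d
  ... | no πg≢πg' rewrite ≡ᵇ-false πg≢πg' with notAnti⇒gap-partner 1≤g g≤d πg≢πg'
  ...   | h , 1≤h , h≤d , h≢g , σh≡σg =
    isSingleton-false⁺ {f = σ} (proj₁ h-range) (proj₂ h-range)
                       (λ gh≡gg → h≢g (gapAfter-injective 1≤h h≤d 1≤g g≤d gh≡gg)) σh≡σg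
    where h-range = gapAfter-range 1≤h h≤d

  gap-antisingleton≡singleton : ∀ {k} → 1 ≤ k → k ≤ d → isAnti d σ (gapAfter d k) ≡ isSingleton d π k
  gap-antisingleton≡singleton {suc zero} _ 1≤d with m≤n⇒m<n∨m≡n 1≤d
  ... | inj₂ refl = ≡ᵇ-refl (σ 1)
  ... | inj₁ 1<d rewrite next-gapAfter-first 1<d =
    ≡ᵇ-≡ (λ σ1≡σd → closed⇒first-singleton (gap-block⇒arcClosed ≤-refl 1<d ≤-refl σ1≡σd))
         (λ single → arcClosed⇒gap-block ≤-refl 1<d ≤-refl (first-singleton⇒closed single))
  gap-antisingleton≡singleton {suc (suc k)} _ k≤d rewrite next-gapAfter {d} {suc k} (s≤s z≤n) k≤d =
    ≡ᵇ-≡ (λ σk≡σk' → closed⇒singleton (gap-block⇒arcClosed (s≤s z≤n) ≤-refl k≤d (sym σk≡σk')))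
         (λ single → sym (arcClosed⇒gap-block (s≤s z≤n) ≤-refl k≤d (singleton⇒closed (s≤s z≤n) k≤d single)))

  antisingletons≡singletons : countUpTo d (isAnti d π) ≡ countUpTo d (isSingleton d σ)
  antisingletons≡singletons =
    trans (countUpTo-cong d λ g 1≤g g≤d → sym (gap-singleton≡antisingleton 1≤g g≤d))
          (countUpTo-gapAfter d (isSingleton d σ))

  isInnerBlockMin : ℕ → Bool
  isInnerBlockMin m = isBlockMin π m ∧ not (sameB π m d)

  gap-blockMin-< : ∀ {g} → 1 ≤ g → g < d → isBlockMin σ (gapAfter d g) ≡ not (isInnerBlockMin (suc g))
  gap-blockMin-< {g} 1≤g g<d rewrite gapAfter-< g<d = ≡not not-min⇒inner inner⇒not-min
    where
    not-min⇒inner : isBlockMin σ (d ∸ g) ≡ false → isInnerBlockMin (suc g) ≡ true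
    not-min⇒inner not-min with isBlockMin-false⁻ not-min
    ... | j , 1≤j , j<d-g , σj≡σg
      = cong₂ (λ least last → least ∧ not last)
          (isBlockMin-true⁺ {π} {suc g} λ z 1≤z z<g' πz≡πg' →
             closed (suc g) z ≤-refl g<h 1≤z (≤-trans (≤-pred z<g') (<⇒≤ g<d)) (inj₁ z<g') (sym πz≡πg'))
          (≡ᵇ-false (closed (suc g) d ≤-refl g<h 1≤d ≤-refl (inj₂ h<d)))
      where
      1≤d = ≤-trans 1≤g (<⇒≤ g<d)
      j≤d = ≤-trans (<⇒≤ j<d-g) (m∸n≤m d g)
      gap-h≡j : gapAfter d (d ∸ j) ≡ j
      gap-h≡j = trans (gapAfter-< (∸-monoʳ-< 1≤j j≤d)) (m∸[m∸n]≡n j≤d)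
      h<d = ∸-monoʳ-< {d} {j} {0} 1≤j j≤d
      g<h = ∸-cancelʳ-< {d ∸ j} {g} {d} (subst (_< d ∸ g) (sym (m∸[m∸n]≡n j≤d)) j<d-g)
      closed = gap-block⇒arcClosed 1≤g g<h (<⇒≤ h<d)
                 (trans (cong σ (gapAfter-< g<d)) (trans (sym σj≡σg) (cong σ (sym gap-h≡j))))
    inner⇒not-min : isInnerBlockMin (suc g) ≡ true → isBlockMin σ (d ∸ g) ≡ false
    inner⇒not-min inner with greatestUpTo (λ y → π y ≡ᵇ π (suc g)) d g<d (≡ᵇ-refl (π (suc g)))
    ... | e , g<e , e≤d , πe≡πg' , above =
      isBlockMin-false⁺ {σ} (m<n⇒0<n∸m e<d) (∸-monoʳ-< g<e e≤d) σe≡σg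
      where
      least = proj₁ (∧-true⁻ {isBlockMin π (suc g)} inner)
      πg'≢πd = ≡ᵇ-false⁻ (not-true⁻ (proj₂ (∧-true⁻ {isBlockMin π (suc g)} inner)))
      e<d = ≤∧≢⇒< e≤d λ e≡d → πg'≢πd (trans (sym (≡ᵇ-true⁻ πe≡πg')) (cong π e≡d))
      σe≡σg : σ (d ∸ e) ≡ σ (d ∸ g)
      σe≡σg rewrite sym (gapAfter-< e<d) | sym (gapAfter-< g<d) =
        sym (arcClosed⇒gap-block 1≤g g<e e≤d
              (blockSpan-closed (s≤s z≤n) g<e e≤d (sym (≡ᵇ-true⁻ πe≡πg'))
                (λ z 1≤z z<g' → isBlockMin-true⁻ {π} {suc g} least z 1≤z z<g')
                λ z e<z z≤d → ≡ᵇ-false⁻ (above z e<z z≤d)))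

  gap-blockMin-last : 1 ≤ d → isBlockMin σ (gapAfter d d) ≡ not (isInnerBlockMin 1)
  gap-blockMin-last 1≤d rewrite gapAfter-last d = ≡not not-min⇒inner inner⇒not-min
    where
    not-min⇒inner : isBlockMin σ d ≡ false → isInnerBlockMin 1 ≡ true
    not-min⇒inner not-min with isBlockMin-false⁻ not-min
    ... | j , 1≤j , j<d , σj≡σd =
      cong not (≡ᵇ-false λ π1≡πd → closed d 1 h<d ≤-refl ≤-refl 1≤d (inj₁ (s≤s 1≤h)) (sym π1≡πd))
      where
      1≤h = m<n⇒0<n∸m j<d
      h<d = ∸-monoʳ-< {d} {j} {0} 1≤j (<⇒≤ j<d)
      gap-h≡j : gapAfter d (d ∸ j) ≡ j
      gap-h≡j = trans (gapAfter-< h<d) (m∸[m∸n]≡n (<⇒≤ j<d))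
      closed = gap-block⇒arcClosed 1≤h h<d ≤-refl
                 (trans (cong σ gap-h≡j) (trans σj≡σd (cong σ (sym (gapAfter-last d)))))
    inner⇒not-min : isInnerBlockMin 1 ≡ true → isBlockMin σ d ≡ false
    inner⇒not-min inner
      with leastUpTo (λ y → π y ≡ᵇ π d) d (anyUpTo-true⁺ d _ 1≤d ≤-refl (≡ᵇ-refl (π d)))
    ... | suc zero , _ , _ , π1≡πd , _ = ⊥-elim (true≢false (trans (sym π1≡πd) (not-true⁻ inner)))
    ... | suc (suc h) , _ , 1+h<d , πh'≡πd , least =
      isBlockMin-false⁺ {σ} (m<n⇒0<n∸m 1+h<d) (∸-monoʳ-< {d} {suc h} {0} (s≤s z≤n) (<⇒≤ 1+h<d)) σh≡σd
      where
      σh≡σd : σ (d ∸ suc h) ≡ σ d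
      σh≡σd = begin
        σ (d ∸ suc h)          ≡⟨ cong σ (gapAfter-< 1+h<d) ⟨
        σ (gapAfter d (suc h)) ≡⟨ arcClosed⇒gap-block (s≤s z≤n) 1+h<d ≤-refl closed ⟩
        σ (gapAfter d d)       ≡⟨ cong σ (gapAfter-last d) ⟩
        σ d                    ∎
        where
        open ≡-Reasoning
        closed = blockSpan-closed (s≤s z≤n) 1+h<d ≤-refl (≡ᵇ-true⁻ πh'≡πd)
                   (λ z 1≤z z<h' πz≡πh' → ≡ᵇ-false⁻ (least z 1≤z z<h') (trans πz≡πh' (≡ᵇ-true⁻ πh'≡πd)))
                   λ z d<z z≤d → ⊥-elim (<⇒≱ d<z z≤d)

  gap-blockMin : ∀ {g} → 1 ≤ g → g ≤ d → isBlockMin σ (gapAfter d g) ≡ not (isInnerBlockMin (next d g))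
  gap-blockMin {g} 1≤g g≤d with m≤n⇒m<n∨m≡n g≤d
  ... | inj₁ g<d rewrite next-< g<d = gap-blockMin-< 1≤g g<d
  ... | inj₂ refl rewrite next-last g = gap-blockMin-last 1≤g

  outerBlockMin-unique : 1 ≤ d → countUpTo d (λ m → isBlockMin π m ∧ sameB π m d) ≡ 1
  outerBlockMin-unique 1≤d
    with leastUpTo (λ y → π y ≡ᵇ π d) d (anyUpTo-true⁺ d _ 1≤d ≤-refl (≡ᵇ-refl (π d)))
  ... | m , 1≤m , m≤d , πm≡πd , least =
    countUpTo-unique d _ 1≤m m≤d
      (cong₂ _∧_ (isBlockMin-true⁺ {π} {m} λ j 1≤j j<m πj≡πm →
                    ≡ᵇ-false⁻ (least j 1≤j j<m) (trans πj≡πm (≡ᵇ-true⁻ πm≡πd)))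
                 πm≡πd)
      others
    where
    others : ∀ x → 1 ≤ x → x ≤ d → x ≢ m → (isBlockMin π x ∧ sameB π x d) ≡ false
    others x 1≤x x≤d x≢m with π x ≟ π d
    ... | no πx≢πd rewrite ≡ᵇ-false πx≢πd = ∧-zeroʳ (isBlockMin π x)
    ... | yes πx≡πd rewrite ≡ᵇ-true πx≡πd with <-cmp x m
    ...   | tri< x<m _ _ = ⊥-elim (≡ᵇ-false⁻ (least x 1≤x x<m) πx≡πd)
    ...   | tri≈ _ x≡m _ = ⊥-elim (x≢m x≡m)
    ...   | tri> _ _ m<x = cong (_∧ true) (isBlockMin-false⁺ {π} 1≤m m<x (trans (≡ᵇ-true⁻ πm≡πd) (sym πx≡πd)))

  blockMins-sum : 1 ≤ d → countUpTo d (isBlockMin π) + countUpTo d (isBlockMin σ) ≡ suc d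
  blockMins-sum 1≤d =
    begin
      countUpTo d (isBlockMin π) + countUpTo d (isBlockMin σ)
    ≡⟨ cong₂ _+_ π-mins σ-mins ⟨
      suc inner + countUpTo d (λ m → not (isInnerBlockMin m))
    ≡⟨ cong suc (countUpTo-not d isInnerBlockMin) ⟩
      suc d
    ∎
    where
    open ≡-Reasoning
    inner = countUpTo d isInnerBlockMin
    split : ∀ a b → ind (a ∧ not b) + ind (a ∧ b) ≡ ind a
    split true  true  = refl
    split true  false = refl
    split false _     = refl
    π-mins : suc inner ≡ countUpTo d (isBlockMin π)
    π-mins = begin
      1 + inner
        ≡⟨ +-comm 1 inner ⟩
      inner + 1
        ≡⟨ cong (inner +_) (outerBlockMin-unique 1≤d) ⟨
      inner + countUpTo d (λ m → isBlockMin π m ∧ sameB π m d)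
        ≡⟨ countUpTo-+ d (λ m _ _ → split (isBlockMin π m) (sameB π m d)) ⟩
      countUpTo d (isBlockMin π) ∎
    σ-mins : countUpTo d (λ m → not (isInnerBlockMin m)) ≡ countUpTo d (isBlockMin σ)
    σ-mins = begin
      countUpTo d (λ m → not (isInnerBlockMin m))
        ≡⟨ countUpTo-next d (λ m → not (isInnerBlockMin m)) ⟨
      countUpTo d (λ g → not (isInnerBlockMin (next d g)))
        ≡⟨ countUpTo-cong d (λ g 1≤g g≤d → sym (gap-blockMin 1≤g g≤d)) ⟩
      countUpTo d (λ g → isBlockMin σ (gapAfter d g))
        ≡⟨ countUpTo-gapAfter d (isBlockMin σ) ⟩
      countUpTo d (isBlockMin σ) ∎

-- A family and its associated family cover each point exactly once

inRange : ℕ → ℕ → ℕ → Bool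
inRange a b x = (a ≤ᵇ x) ∧ (x <ᵇ b)

inRange-split : ∀ {a b c} x → a ≤ b → b ≤ c →
                ind (inRange a c x) ≡ ind (inRange a b x) + ind (inRange b c x)
inRange-split {a} {b} {c} x a≤b b≤c with b ≤? x
... | yes b≤x rewrite <ᵇ-false b≤x | ≤ᵇ-true b≤x | ≤ᵇ-true (≤-trans a≤b b≤x) = refl
... | no b≰x rewrite <ᵇ-true (≰⇒> b≰x) | <ᵇ-true (<-≤-trans (≰⇒> b≰x) b≤c) | ≤ᵇ-false (≰⇒> b≰x) =
  sym (+-identityʳ _)

inRange-empty : ∀ a y → inRange a a y ≡ false
inRange-empty a y with a ≤? y
... | yes a≤y rewrite <ᵇ-false a≤y = ∧-zeroʳ (a ≤ᵇ y)
... | no a≰y rewrite ≤ᵇ-false (≰⇒> a≰y) = refl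

inRange-complement : ∀ {d a b y} → a ≤ b → 1 ≤ y → y ≤ d →
                     inRange b (suc d) y ∨ inRange 1 a y ≡ not (inRange a b y)
inRange-complement {d} {a} {b} {y} a≤b 1≤y y≤d
  rewrite ≤ᵇ-true 1≤y | <ᵇ-true (s≤s y≤d) | ∧-identityʳ (b ≤ᵇ y) with y <? a
... | yes y<a rewrite <ᵇ-true y<a | ≤ᵇ-false y<a = ∨-zeroʳ (b ≤ᵇ y)
... | no y≮a rewrite <ᵇ-false (≮⇒≥ y≮a) | ≤ᵇ-true (≮⇒≥ y≮a) | ∨-identityʳ (b ≤ᵇ y) with y <? b
...   | yes y<b rewrite <ᵇ-true y<b = ≤ᵇ-false y<b
...   | no y≮b rewrite <ᵇ-false (≮⇒≥ y≮b) = ≤ᵇ-true (≮⇒≥ y≮b)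

inRange-upper : ∀ {d b y} → 1 ≤ b → 1 ≤ y → y ≤ d → inRange b (suc d) y ≡ not (inRange 1 b y)
inRange-upper {d} {b} {y} 1≤b 1≤y y≤d =
  trans (sym (trans (cong (inRange b (suc d) y ∨_) (inRange-empty 1 y)) (∨-identityʳ _)))
        (inRange-complement 1≤b 1≤y y≤d)

inRange-lower : ∀ {d a y} → a ≤ suc d → 1 ≤ y → y ≤ d → inRange 1 a y ≡ not (inRange a (suc d) y)
inRange-lower {d} {a} {y} a≤d' 1≤y y≤d =
  trans (cong (_∨ inRange 1 a y) (sym (inRange-empty (suc d) y))) (inRange-complement a≤d' 1≤y y≤d)

-- gapAfter d reverses [1, d - 1], so it maps [a, b) onto the gaps in [d + 1 - b, d + 1 - a).
inRange-gapAfter : ∀ {d a b x} → 1 ≤ a → a ≤ b → b ≤ d → x ≤ d →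
                   inRange (suc (d ∸ b)) (suc (d ∸ a)) (gapAfter d x) ≡ inRange a b x
inRange-gapAfter {d} {a} {b} {x} 1≤a a≤b b≤d x≤d with m≤n⇒m<n∨m≡n x≤d
... | inj₂ refl
  rewrite gapAfter-last x | <ᵇ-false (∸-monoʳ-< {x} {a} {0} 1≤a (≤-trans a≤b b≤d)) | <ᵇ-false b≤d =
  trans (∧-zeroʳ _) (sym (∧-zeroʳ _))
... | inj₁ x<d rewrite gapAfter-< x<d with a ≤? x
...   | no a≰x rewrite ≤ᵇ-false (≰⇒> a≰x) | <ᵇ-false (∸-monoʳ-< (≰⇒> a≰x) (≤-trans a≤b b≤d)) = ∧-zeroʳ _
...   | yes a≤x
  rewrite ≤ᵇ-true a≤x | <ᵇ-true (s≤s (∸-monoʳ-≤ d a≤x)) | ∧-identityʳ (suc (d ∸ b) ≤ᵇ d ∸ x) with x <? b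
...     | yes x<b rewrite <ᵇ-true x<b = ≤ᵇ-true (∸-monoʳ-< x<b b≤d)
...     | no x≮b rewrite <ᵇ-false (≮⇒≥ x≮b) = ≤ᵇ-false (s≤s (∸-monoʳ-≤ d (≮⇒≥ x≮b)))

merge : ∀ a b {r} → ind a + ind b + r ≡ 1 → ind (a ∨ b) + r ≡ 1
merge true  true  ()
merge true  false e = e
merge false b     e = e

data OneOf₄ : Bool → Bool → Bool → Bool → Set where
  first  : OneOf₄ true false false false
  second : OneOf₄ false true false false
  third  : OneOf₄ false false true false
  fourth : OneOf₄ false false false true

oneOf₄ : ∀ a b c e → ind a + ind b + ind c + ind e ≡ 1 → OneOf₄ a b c e
oneOf₄ true  false false false _  = first
oneOf₄ false true  false false _  = second
oneOf₄ false false true  false _  = third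
oneOf₄ false false false true  _  = fourth
oneOf₄ true  true  _     _     ()
oneOf₄ true  false true  _     ()
oneOf₄ true  false false true  ()
oneOf₄ false true  true  _     ()
oneOf₄ false true  false true  ()
oneOf₄ false false true  true  ()
oneOf₄ false false false false ()

data OneOf₅ : Bool → Bool → Bool → Bool → Bool → Set where
  first  : OneOf₅ true false false false false
  second : OneOf₅ false true false false false
  third  : OneOf₅ false false true false false
  fourth : OneOf₅ false false false true false
  fifth  : OneOf₅ false false false false true

oneOf₅ : ∀ a b c e f → ind a + ind b + ind c + ind e + ind f ≡ 1 → OneOf₅ a b c e f
oneOf₅ true  false false false false _  = first
oneOf₅ false true  false false false _  = second
oneOf₅ false false true  false false _  = third
oneOf₅ false false false true  false _  = fourth
oneOf₅ false false false false true  _  = fifth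
oneOf₅ true  true  _     _     _     ()
oneOf₅ true  false true  _     _     ()
oneOf₅ true  false false true  _     ()
oneOf₅ true  false false false true  ()
oneOf₅ false true  true  _     _     ()
oneOf₅ false true  false true  _     ()
oneOf₅ false true  false false true  ()
oneOf₅ false false true  true  _     ()
oneOf₅ false false true  false true  ()
oneOf₅ false false false true  true  ()
oneOf₅ false false false false false ()

chain-lo≤d : ∀ {d k₁ lo} L → Chain d k₁ lo L → lo ≤ d
chain-lo≤d ((k , l) ∷ [])    (lo≤k , k≤d , _)   = ≤-trans lo≤k k≤d
chain-lo≤d ((k , l) ∷ p ∷ L) (lo≤k , k≤l , ch) = ≤-trans lo≤k (≤-trans k≤l (<⇒≤ (chain-lo≤d (p ∷ L) ch)))

-- side I and side′ I say whether x is in the interval I of a family, resp. of its associated family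
-- (gap: the interval of S′ made from the gap between [_, l] and [k, _]; closing: that made from the
-- gap after the last interval). end l is the cut point after [k, l]: l + 1 for points, l for
-- antisingletons.
record Sides (d x : ℕ) (end : ℕ → ℕ) (side side′ : Interval → Bool) : Set where
  field
    plain   : ∀ {k l} → k ≤ l → l ≤ d → side (k , l) ≡ inRange k (end l) x
    wrapped : ∀ {k l} → l < k → k ≤ d → side (k , l) ≡ not (inRange (end l) k x)
    gap     : ∀ {l k} → 1 ≤ l → l < k → k ≤ d →
              side′ (suc (d ∸ k) , conv d (d ∸ l)) ≡ inRange (end l) k x
    closing : ∀ {k l} → 1 ≤ k → k ≤ l → l ≤ d →
              side′ (suc (d ∸ k) , conv d (d ∸ l)) ≡ not (inRange k (end l) x)

module Coverage {d x : ℕ} {end : ℕ → ℕ} {side side′ : Interval → Bool} (sides : Sides d x end side side′)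
                (≤end : ∀ l → l ≤ end l) (end≤ : ∀ l → end l ≤ suc l) where
  open Sides sides

  [_,_⟩ : ℕ → ℕ → Bool
  [ a , b ⟩ = inRange a b x

  three-parts : ∀ {a b c e} → a ≤ b → b ≤ c → c ≤ e →
                ind [ a , e ⟩ ≡ ind [ a , b ⟩ + ind [ b , c ⟩ + ind [ c , e ⟩
  three-parts {a} {b} {c} {e} a≤b b≤c c≤e =
    trans (inRange-split x (≤-trans a≤b b≤c) c≤e) (cong (_+ ind [ c , e ⟩) (inRange-split x a≤b b≤c))

  four-arcs : ∀ {a b c e} → a ≤ b → b ≤ c → c ≤ e → OneOf₄ [ a , b ⟩ [ b , c ⟩ [ c , e ⟩ (not [ a , e ⟩)
  four-arcs {a} {b} {c} {e} a≤b b≤c c≤e =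
    oneOf₄ _ _ _ _ (trans (cong (_+ ind (not [ a , e ⟩)) (sym (three-parts a≤b b≤c c≤e))) (ind-not [ a , e ⟩))

  -- [k₁, end lp) is the part of the circle already passed by the chain.
  chain-exactlyOne : ∀ {k₁ lp} L → 1 ≤ k₁ → k₁ ≤ lp → Chain d k₁ (suc lp) L →
                     ind [ k₁ , end lp ⟩ + ind (any side L) + ind (any side′ (assoc d ((k₁ , lp) ∷ L))) ≡ 1
  chain-exactlyOne {k₁} {lp} ((k , l) ∷ []) 1≤k₁ k₁≤lp (lp<k , k≤d , inj₁ (k≤l , l≤d)) =
    regroup (four-arcs (≤-trans k₁≤lp (≤end lp)) (≤-trans (end≤ lp) lp<k) (≤-trans k≤l (≤end l)))
            (plain k≤l l≤d) (gap (≤-trans 1≤k₁ k₁≤lp) lp<k k≤d)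
            (closing 1≤k₁ (≤-trans k₁≤lp (≤-trans (n≤1+n lp) (≤-trans lp<k k≤l))) l≤d)
    where
    regroup : ∀ {r g i o I G O} → OneOf₄ r g i o → I ≡ i → G ≡ g → O ≡ o →
              ind r + ind (I ∨ false) + ind (G ∨ (O ∨ false)) ≡ 1
    regroup first  refl refl refl = refl
    regroup second refl refl refl = refl
    regroup third  refl refl refl = refl
    regroup fourth refl refl refl = refl
  chain-exactlyOne {k₁} {lp} ((k , l) ∷ []) 1≤k₁ k₁≤lp (lp<k , k≤d , inj₂ (1≤l , l<k₁)) =
    regroup (four-arcs (≤-trans (end≤ l) l<k₁) (≤-trans k₁≤lp (≤end lp)) (≤-trans (end≤ lp) lp<k))
            (wrapped (<-trans l<k₁ (≤-trans (s≤s k₁≤lp) lp<k)) k≤d) (gap (≤-trans 1≤k₁ k₁≤lp) lp<k k≤d)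
            (gap 1≤l l<k₁ (≤-trans (≤-trans k₁≤lp (n≤1+n lp)) (≤-trans lp<k k≤d)))
    where
    regroup : ∀ {g′ r g o I G G′} → OneOf₄ g′ r g o → I ≡ o → G ≡ g → G′ ≡ g′ →
              ind r + ind (I ∨ false) + ind (G ∨ (G′ ∨ false)) ≡ 1
    regroup first  refl refl refl = refl
    regroup second refl refl refl = refl
    regroup third  refl refl refl = refl
    regroup fourth refl refl refl = refl
  chain-exactlyOne {k₁} {lp} ((k , l) ∷ p ∷ L) 1≤k₁ k₁≤lp (lp<k , k≤l , ch) =
    regroup (oneOf₅ [ k₁ , end lp ⟩ [ end lp , k ⟩ [ k , end l ⟩ A B
                    (trans (cong (λ n → n + ind A + ind B) (sym split))
                           (chain-exactlyOne (p ∷ L) 1≤k₁ k₁≤l ch)))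
            (plain k≤l (<⇒≤ l<d)) (gap (≤-trans 1≤k₁ k₁≤lp) lp<k (≤-trans k≤l (<⇒≤ l<d)))
    where
    k₁≤l = ≤-trans k₁≤lp (≤-trans (n≤1+n lp) (≤-trans lp<k k≤l))
    l<d = chain-lo≤d (p ∷ L) ch
    A = any side (p ∷ L)
    B = any side′ (assoc d ((k₁ , l) ∷ p ∷ L))
    split = three-parts (≤-trans k₁≤lp (≤end lp)) (≤-trans (end≤ lp) lp<k) (≤-trans k≤l (≤end l))
    regroup : ∀ {r g i a b I G} → OneOf₅ r g i a b → I ≡ i → G ≡ g → ind r + ind (I ∨ a) + ind (G ∨ b) ≡ 1
    regroup first  refl refl = refl
    regroup second refl refl = refl
    regroup third  refl refl = refl
    regroup fourth refl refl = refl
    regroup fifth  refl refl = refl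

  exactlyOne : ∀ S → Family d S → ind (any side S) + ind (any side′ (assoc d S)) ≡ 1
  exactlyOne ((k₁ , l₁) ∷ []) (1≤k₁ , k₁≤d , inj₁ (k₁≤l₁ , l₁≤d))
    rewrite plain k₁≤l₁ l₁≤d | closing 1≤k₁ k₁≤l₁ l₁≤d
          | ∨-identityʳ [ k₁ , end l₁ ⟩ | ∨-identityʳ (not [ k₁ , end l₁ ⟩) =
    ind-not [ k₁ , end l₁ ⟩
  exactlyOne ((k₁ , l₁) ∷ []) (1≤k₁ , k₁≤d , inj₂ (1≤l₁ , l₁<k₁))
    rewrite wrapped l₁<k₁ k₁≤d | gap 1≤l₁ l₁<k₁ k₁≤d
          | ∨-identityʳ [ end l₁ , k₁ ⟩ | ∨-identityʳ (not [ end l₁ , k₁ ⟩) =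
    trans (+-comm (ind (not [ end l₁ , k₁ ⟩)) _) (ind-not [ end l₁ , k₁ ⟩)
  exactlyOne ((k₁ , l₁) ∷ p ∷ L) (1≤k₁ , k₁≤l₁ , ch)
    rewrite plain k₁≤l₁ (<⇒≤ (chain-lo≤d (p ∷ L) ch)) =
    merge [ k₁ , end l₁ ⟩ (any side (p ∷ L)) (chain-exactlyOne (p ∷ L) 1≤k₁ k₁≤l₁ ch)

≤ᵇ≡<ᵇsuc : ∀ m n → (m ≤ᵇ n) ≡ (m <ᵇ suc n)
≤ᵇ≡<ᵇsuc zero    n = refl
≤ᵇ≡<ᵇsuc (suc m) n = refl

inIv-plain : ∀ {d k l} x → k ≤ l → inIv d (k , l) x ≡ inRange k (suc l) x
inIv-plain {k = k} {l} x k≤l rewrite ≤ᵇ-true k≤l = cong ((k ≤ᵇ x) ∧_) (≤ᵇ≡<ᵇsuc x l)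

inIv-wrapped : ∀ {d k l} x → l < k → inIv d (k , l) x ≡ inRange k (suc d) x ∨ inRange 1 (suc l) x
inIv-wrapped {d} {k} {l} x l<k rewrite ≤ᵇ-false l<k =
  cong₂ (λ a b → ((k ≤ᵇ x) ∧ a) ∨ ((1 ≤ᵇ x) ∧ b)) (≤ᵇ≡<ᵇsuc x d) (≤ᵇ≡<ᵇsuc x l)

antiInIv : ℕ → Interval → ℕ → Bool
antiInIv d I k = if k ≡ᵇ d then isWrapped I else (inIv d I k ∧ inIv d I (suc k) ∧ not (k ≡ᵇ proj₂ I))

antiIn≡any-antiInIv : ∀ d T k → antiIn d T k ≡ any (λ I → antiInIv d I k) T
antiIn≡any-antiInIv d T k with k ≡ᵇ d
... | true  = refl
... | false = refl

antiInIv-plain : ∀ {d k l g} → k ≤ l → l ≤ d → g ≤ d → antiInIv d (k , l) g ≡ inRange k l g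
antiInIv-plain {d} {k} {l} {g} k≤l l≤d g≤d with m≤n⇒m<n∨m≡n g≤d
... | inj₂ refl rewrite ≡ᵇ-refl g | <ᵇ-false {g} {l} l≤d = trans (<ᵇ-false k≤l) (sym (∧-zeroʳ (k ≤ᵇ g)))
... | inj₁ g<d rewrite ≡ᵇ-false (<⇒≢ g<d) | inIv-plain {d} g k≤l | inIv-plain {d} (suc g) k≤l with k ≤? g
...   | no k≰g rewrite ≤ᵇ-false (≰⇒> k≰g) = refl
...   | yes k≤g rewrite ≤ᵇ-true k≤g | ≤ᵇ-true (m≤n⇒m≤1+n k≤g) with <-cmp g l
...     | tri< g<l _ _ rewrite <ᵇ-true g<l | <ᵇ-true (m≤n⇒m≤1+n g<l) | ≡ᵇ-false (<⇒≢ g<l) = refl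
...     | tri≈ _ refl _ rewrite <ᵇ-false (≤-refl {g}) = ∧-zeroʳ (g <ᵇ suc g)
...     | tri> _ _ l<g rewrite <ᵇ-false (<⇒≤ l<g) = ∧-zeroʳ (g <ᵇ suc l)

antiInIv-wrapped : ∀ {d k l g} → l < k → k ≤ d → 1 ≤ g → g ≤ d →
                 antiInIv d (k , l) g ≡ inRange k (suc d) g ∨ inRange 1 l g
antiInIv-wrapped {d} {k} {l} {g} l<k k≤d 1≤g g≤d with m≤n⇒m<n∨m≡n g≤d
... | inj₂ refl rewrite ≡ᵇ-refl g | <ᵇ-true l<k | ≤ᵇ-true k≤d | <ᵇ-true (≤-refl {suc g}) = refl
... | inj₁ g<d
  rewrite ≡ᵇ-false (<⇒≢ g<d) | inIv-wrapped {d} g l<k | inIv-wrapped {d} (suc g) l<k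
        | <ᵇ-true (m≤n⇒m≤1+n g<d) | <ᵇ-true (s≤s g<d) | ≤ᵇ-true 1≤g
        | ∧-identityʳ (k ≤ᵇ g) | ∧-identityʳ (k ≤ᵇ suc g) with k ≤? g
...   | yes k≤g rewrite ≤ᵇ-true k≤g | ≤ᵇ-true (m≤n⇒m≤1+n k≤g) | ≡ᵇ-false (>⇒≢ (<-≤-trans l<k k≤g)) = refl
...   | no k≰g rewrite ≤ᵇ-false (≰⇒> k≰g) with <-cmp g l
...     | tri< g<l _ _
  rewrite <ᵇ-true g<l | <ᵇ-true (m≤n⇒m≤1+n g<l) | ≡ᵇ-false (<⇒≢ g<l) | ∨-zeroʳ (k ≤ᵇ suc g) = refl
...     | tri≈ _ refl _
  rewrite ≡ᵇ-refl g | <ᵇ-false (≤-refl {g}) | ∧-zeroʳ ((k ≤ᵇ suc g) ∨ false) = ∧-zeroʳ (g <ᵇ suc g)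
...     | tri> _ _ l<g rewrite <ᵇ-false (<⇒≤ l<g) | <ᵇ-false l<g = refl

conv-< : ∀ {d l} → l < d → conv d (d ∸ l) ≡ d ∸ l
conv-< l<d rewrite ≡ᵇ-false (m>n⇒m∸n≢0 l<d) = refl

conv-last : ∀ d → conv d (d ∸ d) ≡ d
conv-last d rewrite n∸n≡0 d = refl

assoc-antiInIv-gap : ∀ {d l k x} → 1 ≤ l → l < k → k ≤ d → 1 ≤ x → x ≤ d →
                   antiInIv d (suc (d ∸ k) , conv d (d ∸ l)) (gapAfter d x) ≡ inRange (suc l) k x
assoc-antiInIv-gap {d} {l} {k} {x} 1≤l l<k k≤d 1≤x x≤d rewrite conv-< (<-≤-trans l<k k≤d) = begin
  antiInIv d (suc (d ∸ k) , d ∸ l) (gapAfter d x)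
    ≡⟨ antiInIv-plain (∸-monoʳ-< l<k k≤d) (m∸n≤m d l) (proj₂ (gapAfter-range 1≤x x≤d)) ⟩
  inRange (suc (d ∸ k)) (d ∸ l) (gapAfter d x)
    ≡⟨ cong (λ c → inRange (suc (d ∸ k)) c (gapAfter d x)) (+-∸-assoc 1 (<-≤-trans l<k k≤d)) ⟩
  inRange (suc (d ∸ k)) (suc (d ∸ suc l)) (gapAfter d x)
    ≡⟨ inRange-gapAfter (s≤s z≤n) l<k k≤d x≤d ⟩
  inRange (suc l) k x ∎
  where open ≡-Reasoning

assoc-inIv-gap : ∀ {d l k x} → 1 ≤ l → l < k → k ≤ d → x ≤ d →
                 inIv d (suc (d ∸ k) , conv d (d ∸ l)) (gapAfter d x) ≡ inRange l k x
assoc-inIv-gap {d} {l} {k} {x} 1≤l l<k k≤d x≤d rewrite conv-< (<-≤-trans l<k k≤d) =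
  trans (inIv-plain (gapAfter d x) (∸-monoʳ-< l<k k≤d)) (inRange-gapAfter 1≤l (<⇒≤ l<k) k≤d x≤d)

assoc-antiInIv-closing : ∀ {d k l x} → 1 ≤ k → k ≤ l → l ≤ d → 1 ≤ x → x ≤ d →
                       antiInIv d (suc (d ∸ k) , conv d (d ∸ l)) (gapAfter d x) ≡ not (inRange k (suc l) x)
assoc-antiInIv-closing {d} {k} {l} {x} 1≤k k≤l l≤d 1≤x x≤d with m≤n⇒m<n∨m≡n l≤d
... | inj₁ l<d rewrite conv-< l<d = begin
  antiInIv d (suc (d ∸ k) , d ∸ l) y
    ≡⟨ antiInIv-wrapped (s≤s (∸-monoʳ-≤ d k≤l)) (∸-monoʳ-< 1≤k (≤-trans k≤l l≤d)) 1≤y y≤d ⟩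
  inRange (suc (d ∸ k)) (suc d) y ∨ inRange 1 (d ∸ l) y
    ≡⟨ inRange-complement (m≤n⇒m≤1+n (∸-monoʳ-≤ d k≤l)) 1≤y y≤d ⟩
  not (inRange (d ∸ l) (suc (d ∸ k)) y)
    ≡⟨ cong (λ c → not (inRange c (suc (d ∸ k)) y)) (+-∸-assoc 1 l<d) ⟩
  not (inRange (suc (d ∸ suc l)) (suc (d ∸ k)) y)
    ≡⟨ cong not (inRange-gapAfter 1≤k (m≤n⇒m≤1+n k≤l) l<d x≤d) ⟩
  not (inRange k (suc l) x) ∎
  where
  open ≡-Reasoning
  y = gapAfter d x
  1≤y = proj₁ (gapAfter-range 1≤x x≤d)
  y≤d = proj₂ (gapAfter-range 1≤x x≤d)
... | inj₂ refl rewrite conv-last l = begin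
  antiInIv l (suc (l ∸ k) , l) y
    ≡⟨ antiInIv-plain (∸-monoʳ-< 1≤k k≤l) ≤-refl y≤d ⟩
  inRange (suc (l ∸ k)) l y
    ≡⟨ cong (λ c → inRange (suc (l ∸ k)) c y) (+-∸-assoc 1 (≤-trans 1≤k k≤l)) ⟩
  inRange (suc (l ∸ k)) (suc (l ∸ 1)) y
    ≡⟨ inRange-gapAfter ≤-refl 1≤k k≤l x≤d ⟩
  inRange 1 k x
    ≡⟨ inRange-lower (m≤n⇒m≤1+n k≤l) 1≤x x≤d ⟩
  not (inRange k (suc l) x) ∎
  where
  open ≡-Reasoning
  y = gapAfter l x
  y≤d = proj₂ (gapAfter-range 1≤x x≤d)

assoc-inIv-closing : ∀ {d k l x} → 1 ≤ k → k ≤ l → l ≤ d → 1 ≤ x → x ≤ d →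
                     inIv d (suc (d ∸ k) , conv d (d ∸ l)) (gapAfter d x) ≡ not (inRange k l x)
assoc-inIv-closing {d} {k} {l} {x} 1≤k k≤l l≤d 1≤x x≤d with m≤n⇒m<n∨m≡n l≤d
... | inj₁ l<d rewrite conv-< l<d = begin
  inIv d (suc (d ∸ k) , d ∸ l) y
    ≡⟨ inIv-wrapped y (s≤s (∸-monoʳ-≤ d k≤l)) ⟩
  inRange (suc (d ∸ k)) (suc d) y ∨ inRange 1 (suc (d ∸ l)) y
    ≡⟨ inRange-complement (s≤s (∸-monoʳ-≤ d k≤l)) 1≤y y≤d ⟩
  not (inRange (suc (d ∸ l)) (suc (d ∸ k)) y)
    ≡⟨ cong not (inRange-gapAfter 1≤k k≤l l≤d x≤d) ⟩
  not (inRange k l x) ∎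
  where
  open ≡-Reasoning
  y = gapAfter d x
  1≤y = proj₁ (gapAfter-range 1≤x x≤d)
  y≤d = proj₂ (gapAfter-range 1≤x x≤d)
... | inj₂ refl rewrite conv-last l = begin
  inIv l (suc (l ∸ k) , l) y
    ≡⟨ inIv-plain y (∸-monoʳ-< 1≤k k≤l) ⟩
  inRange (suc (l ∸ k)) (suc l) y
    ≡⟨ inRange-upper (s≤s z≤n) 1≤y y≤d ⟩
  not (inRange 1 (suc (l ∸ k)) y)
    ≡⟨ cong (λ c → not (inRange (suc c) (suc (l ∸ k)) y)) (n∸n≡0 l) ⟨
  not (inRange (suc (l ∸ l)) (suc (l ∸ k)) y)
    ≡⟨ cong not (inRange-gapAfter 1≤k k≤l ≤-refl x≤d) ⟩
  not (inRange k l x) ∎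
  where
  open ≡-Reasoning
  y = gapAfter l x
  1≤y = proj₁ (gapAfter-range 1≤x x≤d)
  y≤d = proj₂ (gapAfter-range 1≤x x≤d)

pointSides : ∀ {d x} → 1 ≤ x → x ≤ d → Sides d x suc (λ I → inIv d I x) (λ I → antiInIv d I (gapAfter d x))
pointSides {d} {x} 1≤x x≤d = record
  { plain   = λ k≤l _ → inIv-plain x k≤l
  ; wrapped = λ l<k _ → trans (inIv-wrapped x l<k) (inRange-complement l<k 1≤x x≤d)
  ; gap     = λ 1≤l l<k k≤d → assoc-antiInIv-gap 1≤l l<k k≤d 1≤x x≤d
  ; closing = λ 1≤k k≤l l≤d → assoc-antiInIv-closing 1≤k k≤l l≤d 1≤x x≤d
  }

antisingletonSides : ∀ {d g} → 1 ≤ g → g ≤ d →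
                     Sides d g (λ l → l) (λ I → antiInIv d I g) (λ I → inIv d I (gapAfter d g))
antisingletonSides {d} {g} 1≤g g≤d = record
  { plain   = λ k≤l l≤d → antiInIv-plain k≤l l≤d g≤d
  ; wrapped = λ l<k k≤d → trans (antiInIv-wrapped l<k k≤d 1≤g g≤d) (inRange-complement (<⇒≤ l<k) 1≤g g≤d)
  ; gap     = λ 1≤l l<k k≤d → assoc-inIv-gap 1≤l l<k k≤d g≤d
  ; closing = λ 1≤k k≤l l≤d → assoc-inIv-closing 1≤k k≤l l≤d 1≤g g≤d
  }

assoc-antiIn : ∀ {d S x} → Family d S → 1 ≤ x → x ≤ d →
               antiIn d (assoc d S) (gapAfter d x) ≡ not (inFam d S x)
assoc-antiIn {d} {S} {x} fam 1≤x x≤d =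
  trans (antiIn≡any-antiInIv d (assoc d S) (gapAfter d x))
        (≡not-of-ind (Coverage.exactlyOne (pointSides 1≤x x≤d) n≤1+n (λ _ → ≤-refl) S fam))

assoc-inFam : ∀ {d S g} → Family d S → 1 ≤ g → g ≤ d →
              inFam d (assoc d S) (gapAfter d g) ≡ not (antiIn d S g)
assoc-inFam {d} {S} {g} fam 1≤g g≤d rewrite antiIn≡any-antiInIv d S g =
  ≡not-of-ind (Coverage.exactlyOne (antisingletonSides 1≤g g≤d) (λ _ → ≤-refl) n≤1+n S fam)

countUpTo-split-gapAfter : ∀ d (p q p′ q′ : ℕ → Bool) →
  (∀ k → 1 ≤ k → k ≤ d → p′ (gapAfter d k) ≡ p k) → (∀ k → 1 ≤ k → k ≤ d → q′ (gapAfter d k) ≡ not (q k)) →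
  countUpTo d (λ k → p k ∧ q k) + countUpTo d (λ k → p′ k ∧ q′ k) ≡ countUpTo d p
countUpTo-split-gapAfter d p q p′ q′ p′≡p q′≡¬q = begin
  countUpTo d (λ k → p k ∧ q k) + countUpTo d (λ k → p′ k ∧ q′ k)
    ≡⟨ cong (countUpTo d (λ k → p k ∧ q k) +_) (countUpTo-gapAfter d (λ k → p′ k ∧ q′ k)) ⟨
  countUpTo d (λ k → p k ∧ q k) + countUpTo d (λ k → p′ (gapAfter d k) ∧ q′ (gapAfter d k))
    ≡⟨ cong (countUpTo d (λ k → p k ∧ q k) +_)
            (countUpTo-cong d λ k 1≤k k≤d → cong₂ _∧_ (p′≡p k 1≤k k≤d) (q′≡¬q k 1≤k k≤d)) ⟩
  countUpTo d (λ k → p k ∧ q k) + countUpTo d (λ k → p k ∧ not (q k))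
    ≡⟨ countUpTo-+ d (λ k _ _ → split (p k) (q k)) ⟩
  countUpTo d p ∎
  where
  open ≡-Reasoning
  split : ∀ a b → ind (a ∧ b) + ind (a ∧ not b) ≡ ind a
  split true  true  = refl
  split true  false = refl
  split false _     = refl

lemma5p1 : (d : ℕ) → 1 ≤ d → (π : ℕ → ℕ) → IsNC d π →
           (S : List Interval) → Family d S →
           (σ : ℕ → ℕ) → IsAlpha d π σ →
           wtExp d S π + wtExp d (assoc d S) σ ≡ suc d
lemma5p1 d 1≤d π π-nc S fam σ σ-α = begin
  (block d π + sπ + aπ) + (block d σ + sσ + aσ)
    ≡⟨ regroup (block d π) sπ aπ (block d σ) sσ aσ ⟩
  (block d π + (sπ + aσ)) + (block d σ + (aπ + sσ))
    ≡⟨ cong₂ (λ s a → (block d π + s) + (block d σ + a)) singletons-split antisingletons-split ⟩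
  (block d π + countUpTo d (isSingleton d π)) + (block d σ + countUpTo d (isAnti d π))
    ≡⟨ cong (λ a → (block d π + countUpTo d (isSingleton d π)) + (block d σ + a)) antisingletons≡singletons ⟩
  (block d π + countUpTo d (isSingleton d π)) + (block d σ + countUpTo d (isSingleton d σ))
    ≡⟨ cong₂ _+_ (blocks+singletons d π) (blocks+singletons d σ) ⟩
  countUpTo d (isBlockMin π) + countUpTo d (isBlockMin σ)
    ≡⟨ blockMins-sum 1≤d ⟩
  suc d ∎
  where
  open ≡-Reasoning
  open Complement π-nc σ-α
  sπ = countUpTo d (λ k → isSingleton d π k ∧ inFam d S k)
  aπ = countUpTo d (λ k → isAnti d π k ∧ antiIn d S k)
  sσ = countUpTo d (λ k → isSingleton d σ k ∧ inFam d (assoc d S) k)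
  aσ = countUpTo d (λ k → isAnti d σ k ∧ antiIn d (assoc d S) k)
  regroup : ∀ a b c e f g → (a + b + c) + (e + f + g) ≡ (a + (b + g)) + (e + (c + f))
  regroup = solve-∀
  singletons-split : sπ + aσ ≡ countUpTo d (isSingleton d π)
  singletons-split =
    countUpTo-split-gapAfter d (isSingleton d π) (inFam d S) (isAnti d σ) (antiIn d (assoc d S))
      (λ _ → gap-antisingleton≡singleton) (λ _ → assoc-antiIn {S = S} fam)
  antisingletons-split : aπ + sσ ≡ countUpTo d (isAnti d π)
  antisingletons-split =
    countUpTo-split-gapAfter d (isAnti d π) (antiIn d S) (isSingleton d σ) (inFam d (assoc d S))
      (λ _ → gap-singleton≡antisingleton) (λ _ → assoc-inFam {S = S} fam)
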